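{- Let $p$ be a prime. Then $\mathcal{Q}_p$ is the disjoint union $$\mathcal{Q}_p=\bigcup_{\substack{k,l\in\mathbb{Z},\ k\le l\\ k+l\in 2\mathbb{Z}}}\mathcal{K}_p\,m(p^k,p^l)\,\mathcal{K}_p .$$
   Context: $\mathcal{Q}_p=\{M\in\operatorname{GL}_2(\mathbb{Q}_p):\det M\in(\mathbb{Q}_p^\times)^2\}$, $\mathcal{K}_p=\{M\in\operatorname{GL}_2(\mathbb{Z}_p):\det M\in(\mathbb{Z}_p^\times)^2\}$, and $m(a,b)=\begin{pmatrix}a&0\\0&b\end{pmatrix}$. -}

module Defs where

open import Data.Nat as ℕ using (ℕ; zero; suc)
open import Data.Integer as ℤ using (ℤ; +_; -[1+_]; _+_; _*_; -_; _-_)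
open import Data.Integer.Divisibility.Signed using (_∣_; divides; ∣m∣n⇒∣m+n; ∣n⇒∣m*n; ∣m⇒∣m*n; ∣m⇒∣-m)
open import Data.Integer.Solver using (module +-*-Solver)
open import Data.Product using (Σ; _×_; _,_; ∃)
open import Relation.Binary.PropositionalEquality using (_≡_; refl; subst; sym)

-- p-adic integers ℤ_p, as the inverse limit of ℤ/p^n:
-- coherent sequences of integers a₀, a₁, … with a_{n+1} ≡ a_n (mod p^n);
-- a_n represents the image of the element in ℤ/p^nℤ.

pw : ℕ → ℕ → ℤ
pw p n = + (p ℕ.^ n)

record ℤp (p : ℕ) : Set where
  constructor mkℤp
  field
    seq : ℕ → ℤ
    coh : ∀ n → pw p n ∣ (seq (suc n) - seq n)
open ℤp public

_≈ᶻ_ : ∀ {p} → ℤp p → ℤp p → Set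
_≈ᶻ_ {p} a b = ∀ n → pw p n ∣ (seq a n - seq b n)

private
  open +-*-Solver
  add-lem : ∀ a a' b b' → (a' + b') - (a + b) ≡ (a' - a) + (b' - b)
  add-lem = solve 4 (λ a a' b b' → (a' :+ b') :- (a :+ b) := (a' :- a) :+ (b' :- b)) refl
  mul-lem : ∀ a a' b b' → (a' * b') - (a * b) ≡ a' * (b' - b) + (a' - a) * b
  mul-lem = solve 4 (λ a a' b b' → (a' :* b') :- (a :* b) := a' :* (b' :- b) :+ (a' :- a) :* b) refl
  neg-lem : ∀ a a' → (- a') - (- a) ≡ - (a' - a)
  neg-lem = solve 2 (λ a a' → (:- a') :- (:- a) := :- (a' :- a)) refl
  const-lem : ∀ c → c - c ≡ + 0
  const-lem = solve 1 (λ c → c :- c := con (+ 0)) refl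

∣0 : ∀ k → k ∣ + 0
∣0 k = divides (+ 0) refl

infixl 7 _*ᶻ_ _*q_
infixl 6 _+ᶻ_ _+q_ _-q_
infix 8 -ᶻ_ -q_
infix 4 _≈ᶻ_ _≈_ _≈M_
infixl 7 _·_

ιᶻ : ∀ {p} → ℤ → ℤp p
ιᶻ {p} c = mkℤp (λ _ → c) (λ n → subst (pw p n ∣_) (sym (const-lem c)) (∣0 (pw p n)))

_+ᶻ_ : ∀ {p} → ℤp p → ℤp p → ℤp p
_+ᶻ_ {p} a b = mkℤp (λ n → seq a n + seq b n)
  (λ n → subst (pw p n ∣_) (sym (add-lem (seq a n) (seq a (suc n)) (seq b n) (seq b (suc n))))
           (∣m∣n⇒∣m+n (coh a n) (coh b n)))

_*ᶻ_ : ∀ {p} → ℤp p → ℤp p → ℤp p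
_*ᶻ_ {p} a b = mkℤp (λ n → seq a n * seq b n)
  (λ n → subst (pw p n ∣_) (sym (mul-lem (seq a n) (seq a (suc n)) (seq b n) (seq b (suc n))))
           (∣m∣n⇒∣m+n (∣n⇒∣m*n (seq a (suc n)) (coh b n)) (∣m⇒∣m*n (seq b n) (coh a n))))

-ᶻ_ : ∀ {p} → ℤp p → ℤp p
-ᶻ_ {p} a = mkℤp (λ n → - seq a n)
  (λ n → subst (pw p n ∣_) (sym (neg-lem (seq a n) (seq a (suc n)))) (∣m⇒∣-m (coh a n)))

0ᶻ 1ᶻ : ∀ {p} → ℤp p
0ᶻ = ιᶻ (+ 0)
1ᶻ = ιᶻ (+ 1)

IsUnitᶻ : ∀ {p} → ℤp p → Set
IsUnitᶻ {p} x = Σ (ℤp p) λ y → (x *ᶻ y) ≈ᶻ 1ᶻ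

-- p-adic numbers ℚ_p = ℤ_p[1/p]: a pair (e , u) stands for u / p^e.

record ℚp (p : ℕ) : Set where
  constructor _/p^_
  field
    num : ℤp p
    den : ℕ
open ℚp public

_≈_ : ∀ {p} → ℚp p → ℚp p → Set
_≈_ {p} x y = (num x *ᶻ ιᶻ (pw p (den y))) ≈ᶻ (num y *ᶻ ιᶻ (pw p (den x)))

_+q_ : ∀ {p} → ℚp p → ℚp p → ℚp p
_+q_ {p} x y = ((num x *ᶻ ιᶻ (pw p (den y))) +ᶻ (num y *ᶻ ιᶻ (pw p (den x)))) /p^ (den x ℕ.+ den y)

_*q_ : ∀ {p} → ℚp p → ℚp p → ℚp p
x *q y = (num x *ᶻ num y) /p^ (den x ℕ.+ den y)

-q_ : ∀ {p} → ℚp p → ℚp p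
-q x = (-ᶻ num x) /p^ den x

_-q_ : ∀ {p} → ℚp p → ℚp p → ℚp p
x -q y = x +q (-q y)

ι : ∀ {p} → ℤp p → ℚp p
ι u = u /p^ 0

0q 1q : ∀ {p} → ℚp p
0q = ι 0ᶻ
1q = ι 1ᶻ

pPow : (p : ℕ) → ℤ → ℚp p
pPow p (+ n)     = ιᶻ (pw p n) /p^ 0
pPow p -[1+ n ]  = 1ᶻ /p^ (suc n)

IsUnitq : ∀ {p} → ℚp p → Set
IsUnitq {p} x = Σ (ℚp p) λ y → (x *q y) ≈ 1q

record M₂ (A : Set) : Set where
  constructor mat
  field
    m₁₁ m₁₂ m₂₁ m₂₂ : A
open M₂ public

_·_ : ∀ {p} → M₂ (ℚp p) → M₂ (ℚp p) → M₂ (ℚp p)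
X · Y = mat (m₁₁ X *q m₁₁ Y +q m₁₂ X *q m₂₁ Y) (m₁₁ X *q m₁₂ Y +q m₁₂ X *q m₂₂ Y)
            (m₂₁ X *q m₁₁ Y +q m₂₂ X *q m₂₁ Y) (m₂₁ X *q m₁₂ Y +q m₂₂ X *q m₂₂ Y)

det : ∀ {p} → M₂ (ℚp p) → ℚp p
det X = (m₁₁ X *q m₂₂ X) -q (m₁₂ X *q m₂₁ X)

detᶻ : ∀ {p} → M₂ (ℤp p) → ℤp p
detᶻ X = (m₁₁ X *ᶻ m₂₂ X) +ᶻ (-ᶻ (m₁₂ X *ᶻ m₂₁ X))

_≈M_ : ∀ {p} → M₂ (ℚp p) → M₂ (ℚp p) → Set
X ≈M Y = (m₁₁ X ≈ m₁₁ Y) × (m₁₂ X ≈ m₁₂ Y) × (m₂₁ X ≈ m₂₁ Y) × (m₂₂ X ≈ m₂₂ Y)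

ιM : ∀ {p} → M₂ (ℤp p) → M₂ (ℚp p)
ιM X = mat (ι (m₁₁ X)) (ι (m₁₂ X)) (ι (m₂₁ X)) (ι (m₂₂ X))

m : ∀ {p} → ℚp p → ℚp p → M₂ (ℚp p)
m a b = mat a 0q 0q b

InGL₂ : ∀ {p} → M₂ (ℚp p) → Set
InGL₂ M = IsUnitq (det M)

In𝒬 : ∀ {p} → M₂ (ℚp p) → Set
In𝒬 {p} M = InGL₂ M × Σ (ℚp p) λ x → IsUnitq x × (det M ≈ (x *q x))

record In𝒦 {p : ℕ} (M : M₂ (ℚp p)) : Set where
  constructor inK
  field
    integral : M₂ (ℤp p)
    eq       : M ≈M ιM integral
    unit     : IsUnitᶻ (detᶻ integral)
    sqr      : Σ (ℤp p) λ x → IsUnitᶻ x × (detᶻ integral ≈ᶻ (x *ᶻ x))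

InDoubleCoset : (p : ℕ) → ℤ → ℤ → M₂ (ℚp p) → Set
InDoubleCoset p k l M =
  Σ (M₂ (ℚp p)) λ A → Σ (M₂ (ℚp p)) λ B →
    In𝒦 A × In𝒦 B × (M ≈M ((A · m (pPow p k) (pPow p l)) · B))

-- The Smith normal form over the discrete valuation ring ℤₚ. Scaling M ∈ 𝒬ₚ by p^E makes it integral; the largest
-- power of p dividing all entries splits off, an entry of the quotient is then a unit, and elimination by matrices
-- of determinant 1 brings M to A · diag(pᵃ, pᵃ⁺ⁱ u) · B with u a unit. As det M is a square, u = t² for a unit t,
-- so diag(1, u) · B lies in 𝒦ₚ, and the two exponents have even sum. Conversely det(A m(pᵏ, pˡ) B) = det A · det B · pᵏ⁺ˡ
-- is the square of a unit when k + l is even. For uniqueness, k is recovered as the least valuation of an entry of M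
-- (read off from the (1,1) entry of adj(A) · M · adj(B)) and k + l as the valuation of det M.
-- Valuations are not decidable on ℤₚ in general; they exist here because every element valued divides a power of p,
-- which is where the invertibility of det M is used.

module Submission where

open import Algebra.Bundles using (CommutativeRing)
open import Level using (0ℓ)
open import Data.Nat.Base using (ℕ)
open import Data.Nat.Primality using (Prime)

-- The standard library's solvers take coefficients either in ℕ (no subtraction) or in R itself (needing decidable
-- equality on R); here the coefficients are integers, interpreted along the canonical homomorphism ℤ → R.
module CommutativeRingSolver {c ℓ} (R : CommutativeRing c ℓ) where

  open import Data.Nat.Base as ℕ using (ℕ; zero; suc)
  import Data.Nat.Properties as ℕ
  open import Data.Integer.Base as ℤ using (ℤ; +_; -[1+_]; _⊖_; _◃_; sign; ∣_∣)
  import Data.Integer.Properties as ℤ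
  open import Data.Sign.Base as Sign using (Sign)
  open import Data.Maybe.Base using (Maybe; just; nothing)
  open import Relation.Nullary.Decidable.Core using (yes; no)
  import Relation.Binary.PropositionalEquality.Core as ≡
  import Algebra.Solver.Ring.AlmostCommutativeRing as ACR
  import Algebra.Solver.Ring

  open CommutativeRing R
  open import Algebra.Properties.Ring ring using (-‿involutive; -0#≈0#; -1*x≈-x; -‿+-comm)
  open import Algebra.Properties.Semiring.Mult.TCOptimised semiring using (_×_; ×-homo-+; 1+×; ×1-homo-*)
  open import Algebra.Properties.CommutativeSemigroup *-commutativeSemigroup using (interchange)
  open import Algebra.Properties.CommutativeSemigroup +-commutativeSemigroup
    using () renaming (interchange to +-interchange)
  open import Relation.Binary.Reasoning.Setoid setoid

  fromℤ : ℤ → Carrier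
  fromℤ (+ n)    = n × 1#
  fromℤ -[1+ n ] = - (suc n × 1#)

  fromℤ-⊖ : ∀ m n → fromℤ (m ⊖ n) ≈ m × 1# - n × 1#
  fromℤ-⊖ zero    zero    = sym (-‿inverseʳ 0#)
  fromℤ-⊖ (suc m) zero    = begin
    suc m × 1#          ≈⟨ +-identityʳ _ ⟨
    suc m × 1# + 0#     ≈⟨ +-congˡ -0#≈0# ⟨
    suc m × 1# - 0#     ∎
  fromℤ-⊖ zero    (suc n) = sym (+-identityˡ _)
  fromℤ-⊖ (suc m) (suc n) = begin
    fromℤ (suc m ⊖ suc n)             ≡⟨ ≡.cong fromℤ (ℤ.[1+m]⊖[1+n]≡m⊖n m n) ⟩
    fromℤ (m ⊖ n)                     ≈⟨ fromℤ-⊖ m n ⟩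
    m × 1# - n × 1#                   ≈⟨ +-identityˡ _ ⟨
    0# + (m × 1# - n × 1#)            ≈⟨ +-congʳ (-‿inverseʳ 1#) ⟨
    (1# - 1#) + (m × 1# - n × 1#)     ≈⟨ +-interchange 1# (- 1#) (m × 1#) (- (n × 1#)) ⟩
    (1# + m × 1#) + (- 1# - n × 1#)   ≈⟨ +-cong (sym (1+× m 1#)) (-‿+-comm 1# (n × 1#)) ⟩
    suc m × 1# + - (1# + n × 1#)      ≈⟨ +-congˡ (-‿cong (1+× n 1#)) ⟨
    suc m × 1# - suc n × 1#           ∎

  signValue : Sign → Carrier
  signValue Sign.+ = 1#
  signValue Sign.- = - 1#

  signValue-* : ∀ s t → signValue (s Sign.* t) ≈ signValue s * signValue t
  signValue-* Sign.+ t      = sym (*-identityˡ _)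
  signValue-* Sign.- Sign.+ = sym (*-identityʳ _)
  signValue-* Sign.- Sign.- = sym (trans (-1*x≈-x _) (-‿involutive 1#))

  fromℤ-◃ : ∀ s n → fromℤ (s ◃ n) ≈ signValue s * (n × 1#)
  fromℤ-◃ s      zero    = sym (zeroʳ _)
  fromℤ-◃ Sign.+ (suc n) = sym (*-identityˡ _)
  fromℤ-◃ Sign.- (suc n) = sym (-1*x≈-x _)

  fromℤ-sign-abs : ∀ i → fromℤ i ≈ signValue (sign i) * (∣ i ∣ × 1#)
  fromℤ-sign-abs (+ n)    = sym (*-identityˡ _)
  fromℤ-sign-abs -[1+ n ] = sym (-1*x≈-x _)

  fromℤ-+ : ∀ i j → fromℤ (i ℤ.+ j) ≈ fromℤ i + fromℤ j
  fromℤ-+ (+ m)    (+ n)    = ×-homo-+ 1# m n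
  fromℤ-+ (+ m)    -[1+ n ] = fromℤ-⊖ m (suc n)
  fromℤ-+ -[1+ m ] (+ n)    = trans (fromℤ-⊖ n (suc m)) (+-comm _ _)
  fromℤ-+ -[1+ m ] -[1+ n ] = begin
    - (suc (suc (m ℕ.+ n)) × 1#)         ≡⟨ ≡.cong (λ k → - (suc k × 1#)) (ℕ.+-suc m n) ⟨
    - ((suc m ℕ.+ suc n) × 1#)           ≈⟨ -‿cong (×-homo-+ 1# (suc m) (suc n)) ⟩
    - (suc m × 1# + suc n × 1#)          ≈⟨ -‿+-comm _ _ ⟨
    - (suc m × 1#) - suc n × 1#          ∎

  fromℤ-* : ∀ i j → fromℤ (i ℤ.* j) ≈ fromℤ i * fromℤ j
  fromℤ-* i j = begin
    fromℤ ((sign i Sign.* sign j) ◃ (∣ i ∣ ℕ.* ∣ j ∣))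
      ≈⟨ fromℤ-◃ (sign i Sign.* sign j) (∣ i ∣ ℕ.* ∣ j ∣) ⟩
    signValue (sign i Sign.* sign j) * ((∣ i ∣ ℕ.* ∣ j ∣) × 1#)
      ≈⟨ *-cong (signValue-* (sign i) (sign j)) (×1-homo-* ∣ i ∣ ∣ j ∣) ⟩
    (signValue (sign i) * signValue (sign j)) * ((∣ i ∣ × 1#) * (∣ j ∣ × 1#))
      ≈⟨ interchange _ _ _ _ ⟩
    (signValue (sign i) * (∣ i ∣ × 1#)) * (signValue (sign j) * (∣ j ∣ × 1#))
      ≈⟨ *-cong (fromℤ-sign-abs i) (fromℤ-sign-abs j) ⟨
    fromℤ i * fromℤ j ∎

  fromℤ-neg : ∀ i → fromℤ (ℤ.- i) ≈ - fromℤ i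
  fromℤ-neg (+ zero)  = sym -0#≈0#
  fromℤ-neg (+ suc n) = refl
  fromℤ-neg -[1+ n ]  = sym (-‿involutive _)

  fromℤ-morphism : ℤ.+-*-rawRing ACR.-Raw-AlmostCommutative⟶ ACR.fromCommutativeRing R
  fromℤ-morphism = record
    { ⟦_⟧    = fromℤ
    ; +-homo = fromℤ-+
    ; *-homo = fromℤ-*
    ; -‿homo = fromℤ-neg
    ; 0-homo = refl
    ; 1-homo = refl
    }

  fromℤ-≈? : ∀ i j → Maybe (fromℤ i ≈ fromℤ j)
  fromℤ-≈? i j with i ℤ.≟ j
  ... | yes ≡.refl = just refl
  ... | no _       = nothing

  open Algebra.Solver.Ring ℤ.+-*-rawRing (ACR.fromCommutativeRing R) fromℤ-morphism fromℤ-≈? public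

module CommutativeRingUnits {c ℓ} (R : CommutativeRing c ℓ) where

  open import Data.Product.Base using (_,_)
  open import Level using (_⊔_)

  open CommutativeRing R
  open import Algebra.Definitions _≈_ using (RightInvertible)
  open import Algebra.Properties.CommutativeSemigroup *-commutativeSemigroup using (interchange)

  IsUnit : Carrier → Set (c ⊔ ℓ)
  IsUnit = RightInvertible 1# _*_

  IsUnit-resp : ∀ {x y} → x ≈ y → IsUnit y → IsUnit x
  IsUnit-resp x≈y (z , yz≈1) = z , trans (*-congʳ x≈y) yz≈1

  *-≈1 : ∀ {x y} → x ≈ 1# → y ≈ 1# → x * y ≈ 1#
  *-≈1 x≈1 y≈1 = trans (*-cong x≈1 y≈1) (*-identityʳ 1#)

  IsUnit-1 : IsUnit 1#
  IsUnit-1 = 1# , *-identityʳ 1#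

  IsUnit-* : ∀ {x y} → IsUnit x → IsUnit y → IsUnit (x * y)
  IsUnit-* {x} {y} (x′ , xx′≈1) (y′ , yy′≈1) = x′ * y′ , trans (interchange x y x′ y′) (*-≈1 xx′≈1 yy′≈1)

  unit-cancelˡ : ∀ {x x′ y z} → x * x′ ≈ 1# → x * y ≈ z → y ≈ x′ * z
  unit-cancelˡ {x} {x′} {y} {z} xx′≈1 xy≈z = begin
    y              ≈⟨ *-identityˡ y ⟨
    1# * y         ≈⟨ *-congʳ xx′≈1 ⟨
    (x * x′) * y   ≈⟨ *-congʳ (*-comm x x′) ⟩
    (x′ * x) * y   ≈⟨ *-assoc x′ x y ⟩
    x′ * (x * y)   ≈⟨ *-congˡ xy≈z ⟩
    x′ * z         ∎
    where open import Relation.Binary.Reasoning.Setoid setoid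

module Matrix₂ {ℓ} (R : CommutativeRing 0ℓ ℓ) where

  open import Data.Product.Base using (_×_; _,_; Σ)
  open import Data.Sum.Base using (_⊎_; inj₁; inj₂)
  open import Relation.Binary.Bundles using (Setoid)
  open import Relation.Binary.Structures using (IsEquivalence)
  import Relation.Binary.Reasoning.Setoid as SetoidReasoning
  open import Defs using (M₂; mat; m₁₁; m₁₂; m₂₁; m₂₂)

  open CommutativeRing R
  open CommutativeRingUnits R using (IsUnit; IsUnit-resp; *-≈1)
  open CommutativeRingSolver R using (Polynomial; solve; _:+_; _:*_; _:-_; :-_; _:=_; con)
  open import Data.Integer.Base using (+_; -[1+_])

  private
    0ᵖ 1ᵖ -1ᵖ : ∀ {n} → Polynomial n
    0ᵖ  = con (+ 0)
    1ᵖ  = con (+ 1)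
    -1ᵖ = con -[1+ 0 ]

  Mat : Set
  Mat = M₂ Carrier

  infixl 7 _⊙_
  _⊙_ : Mat → Mat → Mat
  X ⊙ Y = mat (m₁₁ X * m₁₁ Y + m₁₂ X * m₂₁ Y) (m₁₁ X * m₁₂ Y + m₁₂ X * m₂₂ Y)
              (m₂₁ X * m₁₁ Y + m₂₂ X * m₂₁ Y) (m₂₁ X * m₁₂ Y + m₂₂ X * m₂₂ Y)

  determinant : Mat → Carrier
  determinant X = m₁₁ X * m₂₂ X - m₁₂ X * m₂₁ X

  diag : Carrier → Carrier → Mat
  diag a b = mat a 0# 0# b

  scale : Carrier → Mat → Mat
  scale s X = mat (s * m₁₁ X) (s * m₁₂ X) (s * m₂₁ X) (s * m₂₂ X)

  adjugate : Mat → Mat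
  adjugate X = mat (m₂₂ X) (- m₁₂ X) (- m₂₁ X) (m₁₁ X)

  I J J⁻¹ : Mat
  I   = diag 1# 1#
  J   = mat 0# 1# (- 1#) 0#
  J⁻¹ = mat 0# (- 1#) 1# 0#

  infix 4 _≋_
  record _≋_ (X Y : Mat) : Set ℓ where
    constructor mk≋
    field
      ≈₁₁ : m₁₁ X ≈ m₁₁ Y
      ≈₁₂ : m₁₂ X ≈ m₁₂ Y
      ≈₂₁ : m₂₁ X ≈ m₂₁ Y
      ≈₂₂ : m₂₂ X ≈ m₂₂ Y
  open _≋_ public

  ≋-isEquivalence : IsEquivalence _≋_
  ≋-isEquivalence = record
    { refl  = mk≋ refl refl refl refl
    ; sym   = λ (mk≋ a b c d) → mk≋ (sym a) (sym b) (sym c) (sym d)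
    ; trans = λ (mk≋ a b c d) (mk≋ a′ b′ c′ d′) → mk≋ (trans a a′) (trans b b′) (trans c c′) (trans d d′)
    }

  ≋-setoid : Setoid 0ℓ ℓ
  ≋-setoid = record { isEquivalence = ≋-isEquivalence }

  open IsEquivalence ≋-isEquivalence public
    using () renaming (refl to ≋-refl; sym to ≋-sym; trans to ≋-trans)

  module ≋-Reasoning = SetoidReasoning ≋-setoid

  ⊙-cong : ∀ {X X′ Y Y′} → X ≋ X′ → Y ≋ Y′ → X ⊙ Y ≋ X′ ⊙ Y′
  ⊙-cong (mk≋ a b c d) (mk≋ a′ b′ c′ d′) = mk≋
    (+-cong (*-cong a a′) (*-cong b c′)) (+-cong (*-cong a b′) (*-cong b d′))
    (+-cong (*-cong c a′) (*-cong d c′)) (+-cong (*-cong c b′) (*-cong d d′))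

  ⊙-congˡ : ∀ {X Y Y′} → Y ≋ Y′ → X ⊙ Y ≋ X ⊙ Y′
  ⊙-congˡ = ⊙-cong ≋-refl

  ⊙-congʳ : ∀ {X X′ Y} → X ≋ X′ → X ⊙ Y ≋ X′ ⊙ Y
  ⊙-congʳ e = ⊙-cong e ≋-refl

  diag-cong : ∀ {a a′ b b′} → a ≈ a′ → b ≈ b′ → diag a b ≋ diag a′ b′
  diag-cong e f = mk≋ e refl refl f

  scale-cong : ∀ s {X Y} → X ≋ Y → scale s X ≋ scale s Y
  scale-cong s (mk≋ a b c d) = mk≋ (*-congˡ a) (*-congˡ b) (*-congˡ c) (*-congˡ d)

  determinant-cong : ∀ {X X′} → X ≋ X′ → determinant X ≈ determinant X′
  determinant-cong (mk≋ a b c d) = +-cong (*-cong a d) (-‿cong (*-cong b c))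

  ⊙-assoc : ∀ X Y Z → (X ⊙ Y) ⊙ Z ≋ X ⊙ (Y ⊙ Z)
  ⊙-assoc (mat a b c d) (mat e f g h) (mat i j k l) =
    mk≋ (entry a b e f g h i k) (entry a b e f g h j l) (entry c d e f g h i k) (entry c d e f g h j l)
    where
    entry : ∀ a b e f g h i j →
            (a * e + b * g) * i + (a * f + b * h) * j ≈ a * (e * i + f * j) + b * (g * i + h * j)
    entry = solve 8 (λ a b e f g h i j →
      (a :* e :+ b :* g) :* i :+ (a :* f :+ b :* h) :* j := a :* (e :* i :+ f :* j) :+ b :* (g :* i :+ h :* j)) refl

  determinant-⊙ : ∀ X Y → determinant (X ⊙ Y) ≈ determinant X * determinant Y
  determinant-⊙ (mat a b c d) (mat e f g h) = solve 8 (λ a b c d e f g h →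
    (a :* e :+ b :* g) :* (c :* f :+ d :* h) :- (a :* f :+ b :* h) :* (c :* e :+ d :* g)
      := (a :* d :- b :* c) :* (e :* h :- f :* g)) refl a b c d e f g h

  determinant-⊙⊙ : ∀ X Y Z → determinant ((X ⊙ Y) ⊙ Z) ≈ (determinant X * determinant Y) * determinant Z
  determinant-⊙⊙ X Y Z = trans (determinant-⊙ (X ⊙ Y) Z) (*-congʳ (determinant-⊙ X Y))

  determinant-diag : ∀ a b → determinant (diag a b) ≈ a * b
  determinant-diag = solve 2 (λ a b → a :* b :- 0ᵖ :* 0ᵖ := a :* b) refl

  determinant-scale : ∀ s X → determinant (scale s X) ≈ (s * s) * determinant X
  determinant-scale s (mat a b c d) = solve 5 (λ s a b c d →
    (s :* a) :* (s :* d) :- (s :* b) :* (s :* c) := (s :* s) :* (a :* d :- b :* c)) refl s a b c d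

  scale-⊙diag⊙ : ∀ s y₁ y₂ A B → scale s ((A ⊙ diag y₁ y₂) ⊙ B) ≋ (A ⊙ diag (s * y₁) (s * y₂)) ⊙ B
  scale-⊙diag⊙ s y₁ y₂ (mat a b c e) (mat f g h i) =
    mk≋ (entry s y₁ y₂ a b f h) (entry s y₁ y₂ a b g i) (entry s y₁ y₂ c e f h) (entry s y₁ y₂ c e g i)
    where
    entry : ∀ s y₁ y₂ x y u v →
            s * ((x * y₁ + y * 0#) * u + (x * 0# + y * y₂) * v)
              ≈ (x * (s * y₁) + y * 0#) * u + (x * 0# + y * (s * y₂)) * v
    entry = solve 7 (λ s y₁ y₂ x y u v →
      s :* ((x :* y₁ :+ y :* 0ᵖ) :* u :+ (x :* 0ᵖ :+ y :* y₂) :* v)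
        := (x :* (s :* y₁) :+ y :* 0ᵖ) :* u :+ (x :* 0ᵖ :+ y :* (s :* y₂)) :* v) refl

  ⊙diag-split : ∀ y₁ y₂ w A B → (A ⊙ diag y₁ (y₂ * w)) ⊙ B ≋ (A ⊙ diag y₁ y₂) ⊙ (diag 1# w ⊙ B)
  ⊙diag-split y₁ y₂ w (mat a b c e) (mat f g h i) =
    mk≋ (entry y₁ y₂ w a b f h) (entry y₁ y₂ w a b g i) (entry y₁ y₂ w c e f h) (entry y₁ y₂ w c e g i)
    where
    entry : ∀ y₁ y₂ w x y u v →
            (x * y₁ + y * 0#) * u + (x * 0# + y * (y₂ * w)) * v
              ≈ (x * y₁ + y * 0#) * (1# * u + 0# * v) + (x * 0# + y * y₂) * (0# * u + w * v)
    entry = solve 7 (λ y₁ y₂ w x y u v →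
      (x :* y₁ :+ y :* 0ᵖ) :* u :+ (x :* 0ᵖ :+ y :* (y₂ :* w)) :* v
        := (x :* y₁ :+ y :* 0ᵖ) :* (1ᵖ :* u :+ 0ᵖ :* v)
           :+ (x :* 0ᵖ :+ y :* y₂) :* (0ᵖ :* u :+ w :* v)) refl

  -- Sandwiching by the adjugates: adjugate X ⊙ (X ⊙ D ⊙ Z) ⊙ adjugate Z = det X · det Z · D for diagonal D.
  m₁₁-of-equal-diagonal-forms : ∀ X y₁ y₂ Z X′ y₁′ y₂′ Z′ →
    (X ⊙ diag y₁ y₂) ⊙ Z ≋ (X′ ⊙ diag y₁′ y₂′) ⊙ Z′ →
    (determinant X * determinant Z) * y₁
      ≈ (m₁₁ (adjugate X ⊙ X′) * m₁₁ (Z′ ⊙ adjugate Z)) * y₁′ + (m₁₂ (adjugate X ⊙ X′) * m₂₁ (Z′ ⊙ adjugate Z)) * y₂′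
  m₁₁-of-equal-diagonal-forms X@(mat a b c d) y₁ y₂ Z@(mat e f g h) X′ y₁′ y₂′ Z′ eq = begin
    (determinant X * determinant Z) * y₁
      ≈⟨ adjugate-sandwich a b c d y₁ y₂ e f g h ⟨
    m₁₁ ((adjugate X ⊙ ((X ⊙ diag y₁ y₂) ⊙ Z)) ⊙ adjugate Z)
      ≈⟨ ≈₁₁ (⊙-cong (⊙-cong (≋-refl {adjugate X}) eq) (≋-refl {adjugate Z})) ⟩
    m₁₁ ((adjugate X ⊙ ((X′ ⊙ D′) ⊙ Z′)) ⊙ adjugate Z)
      ≈⟨ ≈₁₁ regroup ⟩
    m₁₁ (((adjugate X ⊙ X′) ⊙ D′) ⊙ (Z′ ⊙ adjugate Z))
      ≈⟨ diagonal-m₁₁ (m₁₁ U) (m₁₂ U) y₁′ y₂′ (m₁₁ V) (m₂₁ V) ⟩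
    (m₁₁ U * m₁₁ V) * y₁′ + (m₁₂ U * m₂₁ V) * y₂′ ∎
    where
    open SetoidReasoning setoid
    D′ = diag y₁′ y₂′
    U = adjugate X ⊙ X′
    V = Z′ ⊙ adjugate Z
    regroup : (adjugate X ⊙ ((X′ ⊙ D′) ⊙ Z′)) ⊙ adjugate Z ≋ ((adjugate X ⊙ X′) ⊙ D′) ⊙ (Z′ ⊙ adjugate Z)
    regroup = ≋-trans (⊙-congʳ (≋-trans (≋-sym (⊙-assoc (adjugate X) (X′ ⊙ D′) Z′)) (⊙-congʳ (≋-sym (⊙-assoc (adjugate X) X′ D′)))))
                      (⊙-assoc ((adjugate X ⊙ X′) ⊙ D′) Z′ (adjugate Z))
    adjugate-sandwich : ∀ a b c d y₁ y₂ e f g h →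
      (d * ((a * y₁ + b * 0#) * e + (a * 0# + b * y₂) * g) + (- b) * ((c * y₁ + d * 0#) * e + (c * 0# + d * y₂) * g)) * h
        + (d * ((a * y₁ + b * 0#) * f + (a * 0# + b * y₂) * h) + (- b) * ((c * y₁ + d * 0#) * f + (c * 0# + d * y₂) * h)) * (- g)
      ≈ ((a * d - b * c) * (e * h - f * g)) * y₁
    adjugate-sandwich = solve 10 (λ a b c d y₁ y₂ e f g h →
      (d :* ((a :* y₁ :+ b :* 0ᵖ) :* e :+ (a :* 0ᵖ :+ b :* y₂) :* g)
        :+ (:- b) :* ((c :* y₁ :+ d :* 0ᵖ) :* e :+ (c :* 0ᵖ :+ d :* y₂) :* g)) :* h
      :+ (d :* ((a :* y₁ :+ b :* 0ᵖ) :* f :+ (a :* 0ᵖ :+ b :* y₂) :* h)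
        :+ (:- b) :* ((c :* y₁ :+ d :* 0ᵖ) :* f :+ (c :* 0ᵖ :+ d :* y₂) :* h)) :* (:- g)
      := ((a :* d :- b :* c) :* (e :* h :- f :* g)) :* y₁) refl
    diagonal-m₁₁ : ∀ u₁₁ u₁₂ y₁ y₂ v₁₁ v₂₁ →
      (u₁₁ * y₁ + u₁₂ * 0#) * v₁₁ + (u₁₁ * 0# + u₁₂ * y₂) * v₂₁ ≈ (u₁₁ * v₁₁) * y₁ + (u₁₂ * v₂₁) * y₂
    diagonal-m₁₁ = solve 6 (λ u₁₁ u₁₂ y₁ y₂ v₁₁ v₂₁ →
      (u₁₁ :* y₁ :+ u₁₂ :* 0ᵖ) :* v₁₁ :+ (u₁₁ :* 0ᵖ :+ u₁₂ :* y₂) :* v₂₁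
        := (u₁₁ :* v₁₁) :* y₁ :+ (u₁₂ :* v₂₁) :* y₂) refl

  SL₂Diagonalisable : Mat → Set ℓ
  SL₂Diagonalisable C = Σ Mat λ A → Σ Mat λ B →
    determinant A ≈ 1# × determinant B ≈ 1# × C ≋ (A ⊙ diag 1# (determinant C)) ⊙ B

  determinant-⊙-≈1 : ∀ {X Y} → determinant X ≈ 1# → determinant Y ≈ 1# → determinant (X ⊙ Y) ≈ 1#
  determinant-⊙-≈1 {X} {Y} e f = trans (determinant-⊙ X Y) (*-≈1 e f)

  determinant-J : determinant J ≈ 1#
  determinant-J = solve 0 (0ᵖ :* 0ᵖ :- 1ᵖ :* -1ᵖ := 1ᵖ) refl

  determinant-J⁻¹ : determinant J⁻¹ ≈ 1#
  determinant-J⁻¹ = solve 0 (0ᵖ :* 0ᵖ :- -1ᵖ :* 1ᵖ := 1ᵖ) refl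

  ⊙-identityʳ : ∀ X → X ⊙ I ≋ X
  ⊙-identityʳ (mat a b c d) = mk≋ (first a b) (second a b) (first c d) (second c d)
    where
    first : ∀ x y → x * 1# + y * 0# ≈ x
    first = solve 2 (λ x y → x :* 1ᵖ :+ y :* 0ᵖ := x) refl
    second : ∀ x y → x * 0# + y * 1# ≈ y
    second = solve 2 (λ x y → x :* 0ᵖ :+ y :* 1ᵖ := y) refl

  ⊙-identityˡ : ∀ X → I ⊙ X ≋ X
  ⊙-identityˡ (mat a b c d) = mk≋ (first a c) (first b d) (second a c) (second b d)
    where
    first : ∀ x y → 1# * x + 0# * y ≈ x
    first = solve 2 (λ x y → 1ᵖ :* x :+ 0ᵖ :* y := x) refl
    second : ∀ x y → 0# * x + 1# * y ≈ y
    second = solve 2 (λ x y → 0ᵖ :* x :+ 1ᵖ :* y := y) refl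

  J⁻¹⊙J : J⁻¹ ⊙ J ≋ I
  J⁻¹⊙J = mk≋ (solve 0 (0ᵖ :* 0ᵖ :+ -1ᵖ :* -1ᵖ := 1ᵖ) refl) (solve 0 (0ᵖ :* 1ᵖ :+ -1ᵖ :* 0ᵖ := 0ᵖ) refl)
              (solve 0 (1ᵖ :* 0ᵖ :+ 0ᵖ :* -1ᵖ := 0ᵖ) refl) (solve 0 (1ᵖ :* 1ᵖ :+ 0ᵖ :* 0ᵖ := 1ᵖ) refl)

  m₁₁-⊙J⁻¹ : ∀ C → m₁₁ (C ⊙ J⁻¹) ≈ m₁₂ C
  m₁₁-⊙J⁻¹ (mat a b c d) = solve 2 (λ a b → a :* 0ᵖ :+ b :* 1ᵖ := b) refl a b

  m₁₁-J⊙ : ∀ C → m₁₁ (J ⊙ C) ≈ m₂₁ C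
  m₁₁-J⊙ (mat a b c d) = solve 2 (λ a c → 0ᵖ :* a :+ 1ᵖ :* c := c) refl a c

  determinant-⊙J⁻¹ : ∀ C → determinant (C ⊙ J⁻¹) ≈ determinant C
  determinant-⊙J⁻¹ C = trans (determinant-⊙ C J⁻¹) (trans (*-congˡ determinant-J⁻¹) (*-identityʳ _))

  determinant-J⊙ : ∀ C → determinant (J ⊙ C) ≈ determinant C
  determinant-J⊙ C = trans (determinant-⊙ J C) (trans (*-congʳ determinant-J) (*-identityˡ _))

  SL₂Diagonalisable-⊙J⁻¹ : ∀ C → SL₂Diagonalisable (C ⊙ J⁻¹) → SL₂Diagonalisable C
  SL₂Diagonalisable-⊙J⁻¹ C (A , B , det-A , det-B , C⊙J⁻¹≋) =
    A , B ⊙ J , det-A , determinant-⊙-≈1 det-B determinant-J , (begin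
      C                                                    ≈⟨ ⊙-identityʳ C ⟨
      C ⊙ I                                                ≈⟨ ⊙-congˡ J⁻¹⊙J ⟨
      C ⊙ (J⁻¹ ⊙ J)                                        ≈⟨ ⊙-assoc C J⁻¹ J ⟨
      (C ⊙ J⁻¹) ⊙ J                                        ≈⟨ ⊙-congʳ C⊙J⁻¹≋ ⟩
      ((A ⊙ diag 1# (determinant (C ⊙ J⁻¹))) ⊙ B) ⊙ J      ≈⟨ ⊙-assoc _ B J ⟩
      (A ⊙ diag 1# (determinant (C ⊙ J⁻¹))) ⊙ (B ⊙ J)      ≈⟨ ⊙-congʳ (⊙-congˡ (diag-cong refl (determinant-⊙J⁻¹ C))) ⟩
      (A ⊙ diag 1# (determinant C)) ⊙ (B ⊙ J)              ∎)
    where open ≋-Reasoning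

  SL₂Diagonalisable-J⊙ : ∀ C → SL₂Diagonalisable (J ⊙ C) → SL₂Diagonalisable C
  SL₂Diagonalisable-J⊙ C (A , B , det-A , det-B , J⊙C≋) =
    J⁻¹ ⊙ A , B , determinant-⊙-≈1 determinant-J⁻¹ det-A , det-B , (begin
      C                                                    ≈⟨ ⊙-identityˡ C ⟨
      I ⊙ C                                                ≈⟨ ⊙-congʳ J⁻¹⊙J ⟨
      (J⁻¹ ⊙ J) ⊙ C                                        ≈⟨ ⊙-assoc J⁻¹ J C ⟩
      J⁻¹ ⊙ (J ⊙ C)                                        ≈⟨ ⊙-congˡ J⊙C≋ ⟩
      J⁻¹ ⊙ ((A ⊙ diag 1# (determinant (J ⊙ C))) ⊙ B)      ≈⟨ ⊙-assoc J⁻¹ _ B ⟨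
      (J⁻¹ ⊙ (A ⊙ diag 1# (determinant (J ⊙ C)))) ⊙ B      ≈⟨ ⊙-congʳ (⊙-assoc J⁻¹ A _) ⟨
      ((J⁻¹ ⊙ A) ⊙ diag 1# (determinant (J ⊙ C))) ⊙ B      ≈⟨ ⊙-congʳ (⊙-congˡ (diag-cong refl (determinant-J⊙ C))) ⟩
      ((J⁻¹ ⊙ A) ⊙ diag 1# (determinant C)) ⊙ B            ∎)
    where open ≋-Reasoning

  -- Gaussian elimination around the invertible corner a:  (a b; c d) = (a 0; c a⁻¹) · diag(1, ad − bc) · (1 a⁻¹b; 0 1).
  m₁₁-unit⇒SL₂Diagonalisable : ∀ C → IsUnit (m₁₁ C) → SL₂Diagonalisable C
  m₁₁-unit⇒SL₂Diagonalisable (mat a b c d) (e , ae≈1) =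
    L , U , determinant-L , determinant-U , ≋-sym (mk≋ entry₁₁ entry₁₂ entry₂₁ entry₂₂)
    where
    L U : Mat
    L = mat a 0# c e
    U = mat 1# (e * b) 0# 1#
    δ : Carrier
    δ = a * d - b * c
    LDR : Mat
    LDR = (L ⊙ diag 1# δ) ⊙ U
    unit-cancel : ∀ x → (a * e) * x ≈ x
    unit-cancel x = trans (*-congʳ ae≈1) (*-identityˡ x)
    determinant-L : determinant L ≈ 1#
    determinant-L = trans (solve 3 (λ a c e → a :* e :- 0ᵖ :* c := a :* e) refl a c e) ae≈1
    determinant-U : determinant U ≈ 1#
    determinant-U = solve 1 (λ x → 1ᵖ :* 1ᵖ :- x :* 0ᵖ := 1ᵖ) refl (e * b)
    entry₁₁ : m₁₁ LDR ≈ a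
    entry₁₁ = solve 2 (λ a δ → (a :* 1ᵖ :+ 0ᵖ :* 0ᵖ) :* 1ᵖ :+ (a :* 0ᵖ :+ 0ᵖ :* δ) :* 0ᵖ := a) refl a δ
    entry₁₂ : m₁₂ LDR ≈ b
    entry₁₂ = trans (solve 4 (λ a b δ e → (a :* 1ᵖ :+ 0ᵖ :* 0ᵖ) :* (e :* b) :+ (a :* 0ᵖ :+ 0ᵖ :* δ) :* 1ᵖ
                                          := (a :* e) :* b) refl a b δ e)
                    (unit-cancel b)
    entry₂₁ : m₂₁ LDR ≈ c
    entry₂₁ = solve 3 (λ c e δ → (c :* 1ᵖ :+ e :* 0ᵖ) :* 1ᵖ :+ (c :* 0ᵖ :+ e :* δ) :* 0ᵖ := c) refl c e δ
    entry₂₂ : m₂₂ LDR ≈ d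
    entry₂₂ = trans (solve 5 (λ a b c d e → (c :* 1ᵖ :+ e :* 0ᵖ) :* (e :* b) :+ (c :* 0ᵖ :+ e :* (a :* d :- b :* c)) :* 1ᵖ
                                             := (a :* e) :* d) refl a b c d e)
                    (unit-cancel d)

  m₂₁-⊙J⁻¹ : ∀ C → m₂₁ (C ⊙ J⁻¹) ≈ m₂₂ C
  m₂₁-⊙J⁻¹ (mat a b c d) = solve 2 (λ c d → c :* 0ᵖ :+ d :* 1ᵖ := d) refl c d

  m₂₁-unit⇒SL₂Diagonalisable : ∀ C → IsUnit (m₂₁ C) → SL₂Diagonalisable C
  m₂₁-unit⇒SL₂Diagonalisable C u =
    SL₂Diagonalisable-J⊙ C (m₁₁-unit⇒SL₂Diagonalisable (J ⊙ C) (IsUnit-resp (m₁₁-J⊙ C) u))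

  unit-entry⇒SL₂Diagonalisable : ∀ C →
    IsUnit (m₁₁ C) ⊎ IsUnit (m₁₂ C) ⊎ IsUnit (m₂₁ C) ⊎ IsUnit (m₂₂ C) → SL₂Diagonalisable C
  unit-entry⇒SL₂Diagonalisable C (inj₁ u) = m₁₁-unit⇒SL₂Diagonalisable C u
  unit-entry⇒SL₂Diagonalisable C (inj₂ (inj₁ u)) =
    SL₂Diagonalisable-⊙J⁻¹ C (m₁₁-unit⇒SL₂Diagonalisable (C ⊙ J⁻¹) (IsUnit-resp (m₁₁-⊙J⁻¹ C) u))
  unit-entry⇒SL₂Diagonalisable C (inj₂ (inj₂ (inj₁ u))) = m₂₁-unit⇒SL₂Diagonalisable C u
  unit-entry⇒SL₂Diagonalisable C (inj₂ (inj₂ (inj₂ u))) =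
    SL₂Diagonalisable-⊙J⁻¹ C (m₂₁-unit⇒SL₂Diagonalisable (C ⊙ J⁻¹) (IsUnit-resp (m₂₁-⊙J⁻¹ C) u))

module PAdicIntegers (p : ℕ) (p-prime : Prime p) where

  open import Data.Nat.Base as ℕ using (zero; suc; _≤_; NonZero)
  import Data.Nat.Properties as ℕ
  open import Data.Nat.Primality using (prime⇒nonZero; prime⇒nonTrivial; prime⇒irreducible)
  import Data.Nat.Divisibility as ℕ
  open import Data.Nat.Coprimality using (Coprime; coprime-Bézout)
  import Data.Nat.GCD as ℕ
  open import Data.Integer.Base as ℤ using (ℤ; +_; -[1+_])
  import Data.Integer.Properties as ℤ
  import Relation.Binary.Reasoning.Setoid
  open import Relation.Binary.PropositionalEquality using (module ≡-Reasoning)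
  open import Data.Integer.Divisibility.Signed
  open import Data.Integer.Solver using (module +-*-Solver)
  open import Data.Product.Base using (Σ; _×_; _,_; proj₁; proj₂)
  open import Data.Sum.Base using (inj₁; inj₂)
  open import Relation.Nullary using (¬_; Dec; yes; no; contradiction)
  open import Relation.Nullary.Decidable using (map′)
  open import Relation.Binary.PropositionalEquality.Core using (_≡_; refl; subst; subst₂; sym; trans; cong; cong₂)
  open import Algebra.Bundles using (CommutativeRing)
  open import Algebra.Structures using (IsCommutativeRing)
  open import Level using (0ℓ)
  open import Defs

  open +-*-Solver

  ℤₚ : Set
  ℤₚ = ℤp p

  -- A record rather than the bare ∀-type, so that both sides can be inferred from a proof.
  infix 4 _≈z_
  record _≈z_ (a b : ℤₚ) : Set where
    constructor mk≈z
    field un≈z : a ≈ᶻ b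
  open _≈z_ public

  instance
    p-nonZero : NonZero p
    p-nonZero = prime⇒nonZero p-prime

  pw-nonZero : ∀ n → ℤ.NonZero (pw p n)
  pw-nonZero n = ℕ.m^n≢0 p n

  private
    y-x≡-[x-y] : ∀ x y → y ℤ.- x ≡ ℤ.- (x ℤ.- y)
    y-x≡-[x-y] = solve 2 (λ x y → y :- x := :- (x :- y)) refl
    x-z≡[x-y]+[y-z] : ∀ x y z → x ℤ.- z ≡ (x ℤ.- y) ℤ.+ (y ℤ.- z)
    x-z≡[x-y]+[y-z] = solve 3 (λ x y z → x :- z := (x :- y) :+ (y :- z)) refl
    +-diff : ∀ a a′ b b′ → (a ℤ.+ b) ℤ.- (a′ ℤ.+ b′) ≡ (a ℤ.- a′) ℤ.+ (b ℤ.- b′)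
    +-diff = solve 4 (λ a a′ b b′ → (a :+ b) :- (a′ :+ b′) := (a :- a′) :+ (b :- b′)) refl
    *-diff : ∀ a a′ b b′ → (a ℤ.* b) ℤ.- (a′ ℤ.* b′) ≡ a ℤ.* (b ℤ.- b′) ℤ.+ (a ℤ.- a′) ℤ.* b′
    *-diff = solve 4 (λ a a′ b b′ → (a :* b) :- (a′ :* b′) := a :* (b :- b′) :+ (a :- a′) :* b′) refl
    [-a]-[-b]≡-[a-b] : ∀ a a′ → (ℤ.- a) ℤ.- (ℤ.- a′) ≡ ℤ.- (a ℤ.- a′)
    [-a]-[-b]≡-[a-b] = solve 2 (λ a a′ → (:- a) :- (:- a′) := :- (a :- a′)) refl
    x≡x-y+y : ∀ x y → x ≡ (x ℤ.- y) ℤ.+ y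
    x≡x-y+y = solve 2 (λ x y → x := (x :- y) :+ y) refl
    x*k-y*k≡[x-y]*k : ∀ a b k → a ℤ.* k ℤ.- b ℤ.* k ≡ (a ℤ.- b) ℤ.* k
    x*k-y*k≡[x-y]*k = solve 3 (λ a b k → a :* k :- b :* k := (a :- b) :* k) refl

  ≈z-pointwise : ∀ {a b} → (∀ n → seq a n ≡ seq b n) → a ≈z b
  ≈z-pointwise {a} {b} e = mk≈z λ n →
    subst (λ x → pw p n ∣ x ℤ.- seq b n) (sym (e n)) (subst (pw p n ∣_) (sym (ℤ.+-inverseʳ (seq b n))) (∣0 (pw p n)))

  ≈z-sym : ∀ {a b} → a ≈z b → b ≈z a
  ≈z-sym {a} {b} (mk≈z e) = mk≈z λ n → subst (pw p n ∣_) (sym (y-x≡-[x-y] (seq a n) (seq b n))) (∣m⇒∣-m (e n))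

  ≈z-trans : ∀ {a b c} → a ≈z b → b ≈z c → a ≈z c
  ≈z-trans {a} {b} {c} (mk≈z e) (mk≈z f) = mk≈z λ n →
    subst (pw p n ∣_) (sym (x-z≡[x-y]+[y-z] (seq a n) (seq b n) (seq c n))) (∣m∣n⇒∣m+n (e n) (f n))

  +ᶻ-cong : ∀ {a a′ b b′} → a ≈z a′ → b ≈z b′ → (a +ᶻ b) ≈z (a′ +ᶻ b′)
  +ᶻ-cong {a} {a′} {b} {b′} (mk≈z e) (mk≈z f) = mk≈z λ n →
    subst (pw p n ∣_) (sym (+-diff (seq a n) (seq a′ n) (seq b n) (seq b′ n))) (∣m∣n⇒∣m+n (e n) (f n))

  *ᶻ-cong : ∀ {a a′ b b′} → a ≈z a′ → b ≈z b′ → (a *ᶻ b) ≈z (a′ *ᶻ b′)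
  *ᶻ-cong {a} {a′} {b} {b′} (mk≈z e) (mk≈z f) = mk≈z λ n →
    subst (pw p n ∣_) (sym (*-diff (seq a n) (seq a′ n) (seq b n) (seq b′ n)))
      (∣m∣n⇒∣m+n (∣n⇒∣m*n (seq a n) (f n)) (∣m⇒∣m*n (seq b′ n) (e n)))

  -ᶻ-cong : ∀ {a a′} → a ≈z a′ → (-ᶻ a) ≈z (-ᶻ a′)
  -ᶻ-cong {a} {a′} (mk≈z e) = mk≈z λ n → subst (pw p n ∣_) (sym ([-a]-[-b]≡-[a-b] (seq a n) (seq a′ n))) (∣m⇒∣-m (e n))

  -- Sealed copies of the operations: conversion checking then never unfolds ring expressions into sequences.
  infixl 6 _+ₚ_
  infixl 7 _*ₚ_
  infix  8 -ₚ_
  opaque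
    _+ₚ_ _*ₚ_ : ℤₚ → ℤₚ → ℤₚ
    _+ₚ_ = _+ᶻ_
    _*ₚ_ = _*ᶻ_

    -ₚ_ : ℤₚ → ℤₚ
    -ₚ_ = -ᶻ_

    0ₚ 1ₚ : ℤₚ
    0ₚ = 0ᶻ
    1ₚ = 1ᶻ

  opaque
    unfolding _+ₚ_
    ℤₚ-isCommutativeRing : IsCommutativeRing _≈z_ _+ₚ_ _*ₚ_ -ₚ_ 0ₚ 1ₚ
    ℤₚ-isCommutativeRing = record
      { isRing = record
        { +-isAbelianGroup = record
          { isGroup = record
            { isMonoid = record
              { isSemigroup = record
                { isMagma = record
                  { isEquivalence = record { refl = ≈z-pointwise (λ _ → refl) ; sym = ≈z-sym ; trans = ≈z-trans }
                  ; ∙-cong = +ᶻ-cong }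
                ; assoc = λ x y z → ≈z-pointwise (λ n → ℤ.+-assoc (seq x n) (seq y n) (seq z n)) }
              ; identity = (λ x → ≈z-pointwise (λ n → ℤ.+-identityˡ (seq x n)))
                         , (λ x → ≈z-pointwise (λ n → ℤ.+-identityʳ (seq x n))) }
            ; inverse = (λ x → ≈z-pointwise (λ n → ℤ.+-inverseˡ (seq x n)))
                      , (λ x → ≈z-pointwise (λ n → ℤ.+-inverseʳ (seq x n)))
            ; ⁻¹-cong = -ᶻ-cong }
          ; comm = λ x y → ≈z-pointwise (λ n → ℤ.+-comm (seq x n) (seq y n)) }
        ; *-cong = *ᶻ-cong
        ; *-assoc = λ x y z → ≈z-pointwise (λ n → ℤ.*-assoc (seq x n) (seq y n) (seq z n))
        ; *-identity = (λ x → ≈z-pointwise (λ n → ℤ.*-identityˡ (seq x n)))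
                     , (λ x → ≈z-pointwise (λ n → ℤ.*-identityʳ (seq x n)))
        ; distrib = (λ x y z → ≈z-pointwise (λ n → ℤ.*-distribˡ-+ (seq x n) (seq y n) (seq z n)))
                  , (λ x y z → ≈z-pointwise (λ n → ℤ.*-distribʳ-+ (seq x n) (seq y n) (seq z n))) }
      ; *-comm = λ x y → ≈z-pointwise (λ n → ℤ.*-comm (seq x n) (seq y n)) }

  ℤₚ-ring : CommutativeRing 0ℓ 0ℓ
  ℤₚ-ring = record { isCommutativeRing = ℤₚ-isCommutativeRing }

  open CommutativeRing ℤₚ-ring using (*-cong; *-congˡ; *-congʳ; *-assoc; *-comm; *-identityʳ)
  open CommutativeRingUnits ℤₚ-ring using (IsUnit; IsUnit-1)
  opaque
    unfolding _+ₚ_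
    IsUnitᶻ⇒IsUnit : ∀ {x} → IsUnitᶻ x → IsUnit x
    IsUnitᶻ⇒IsUnit (y , xy≈1) = y , mk≈z xy≈1

    IsUnit⇒IsUnitᶻ : ∀ {x} → IsUnit x → IsUnitᶻ x
    IsUnit⇒IsUnitᶻ (y , mk≈z xy≈1) = y , xy≈1

    *ₚ≈*ᶻ : ∀ a b → a *ₚ b ≈z a *ᶻ b
    *ₚ≈*ᶻ a b = ≈z-pointwise (λ _ → refl)

  module ≈z-Reasoning = Relation.Binary.Reasoning.Setoid (CommutativeRing.setoid ℤₚ-ring)

  infix 25 p^_
  opaque
    p^_ : ℕ → ℤₚ
    p^ k = ιᶻ (pw p k)

  pw-+ : ∀ a b → pw p (a ℕ.+ b) ≡ pw p a ℤ.* pw p b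
  pw-+ a b = trans (cong +_ (ℕ.^-distribˡ-+-* p a b)) (ℤ.pos-* (p ℕ.^ a) (p ℕ.^ b))

  pw∣pw : ∀ n j → pw p n ∣ pw p (j ℕ.+ n)
  pw∣pw n j = divides (pw p j) (pw-+ j n)

  opaque
    unfolding p^_ _+ₚ_
    p^-+ : ∀ a b → p^ (a ℕ.+ b) ≈z p^ a *ₚ p^ b
    p^-+ a b = ≈z-pointwise (λ _ → pw-+ a b)

  seq-coherent : ∀ (a : ℤₚ) n j → pw p n ∣ (seq a (j ℕ.+ n) ℤ.- seq a n)
  seq-coherent a n zero    = subst (pw p n ∣_) (sym (ℤ.+-inverseʳ (seq a n))) (∣0 (pw p n))
  seq-coherent a n (suc j) = subst (pw p n ∣_) (sym (x-z≡[x-y]+[y-z] (seq a (suc (j ℕ.+ n))) (seq a (j ℕ.+ n)) (seq a n)))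
    (∣m∣n⇒∣m+n (∣-trans (pw∣pw n j) (coh a (j ℕ.+ n))) (seq-coherent a n j))

  opaque
    unfolding p^_ _+ₚ_
    -- Level k + n of the hypothesis gives a ≡ b mod p^n at level k + n, hence at level n by coherence.
    *-p^-cancelʳ : ∀ k {a b} → a *ₚ p^ k ≈z b *ₚ p^ k → a ≈z b
    *-p^-cancelʳ k {a} {b} (mk≈z e) = mk≈z λ n →
      let A = seq a (k ℕ.+ n)
          B = seq b (k ℕ.+ n)
          pⁿ⁺ᵏ∣ : pw p n ℤ.* pw p k ∣ (A ℤ.- B) ℤ.* pw p k
          pⁿ⁺ᵏ∣ = subst₂ _∣_ (trans (cong (pw p) (ℕ.+-comm k n)) (pw-+ n k)) (x*k-y*k≡[x-y]*k A B (pw p k)) (e (k ℕ.+ n))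
          pⁿ∣A-B : pw p n ∣ (A ℤ.- B)
          pⁿ∣A-B = *-cancelʳ-∣ (pw p k) {{pw-nonZero k}} pⁿ⁺ᵏ∣
      in subst (pw p n ∣_) (sym (a-b≡[a-c]+[[c-d]+[d-b]] (seq a n) (seq b n) A B))
           (∣m∣n⇒∣m+n (subst (pw p n ∣_) (sym (y-x≡-[x-y] A (seq a n))) (∣m⇒∣-m (seq-coherent a n k)))
                      (∣m∣n⇒∣m+n pⁿ∣A-B (seq-coherent b n k)))
      where
      a-b≡[a-c]+[[c-d]+[d-b]] : ∀ a b c d → a ℤ.- b ≡ (a ℤ.- c) ℤ.+ ((c ℤ.- d) ℤ.+ (d ℤ.- b))
      a-b≡[a-c]+[[c-d]+[d-b]] = solve 4 (λ a b c d → a :- b := (a :- c) :+ ((c :- d) :+ (d :- b))) refl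

  infix 4 p^[_]∣_
  p^[_]∣_ : ℕ → ℤₚ → Set
  p^[ j ]∣ a = Σ ℤₚ λ c → a ≈z p^ j *ₚ c

  opaque
    unfolding p^_ _+ₚ_
    -- The quotient is assembled level by level from the exact quotients seq a (n + j) / p^j.
    pw∣seq⇒p^∣ : ∀ j a → pw p j ∣ seq a j → p^[ j ]∣ a
    pw∣seq⇒p^∣ j a pʲ∣aⱼ = mkℤp q q-coherent , mk≈z a≈pʲq
      where
      pʲ∣ : ∀ n → pw p j ∣ seq a (n ℕ.+ j)
      pʲ∣ n = subst (pw p j ∣_) (sym (x≡x-y+y (seq a (n ℕ.+ j)) (seq a j))) (∣m∣n⇒∣m+n (seq-coherent a j n) pʲ∣aⱼ)
      q : ℕ → ℤ
      q n = quotient (pʲ∣ n)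
      q-spec : ∀ n → seq a (n ℕ.+ j) ≡ q n ℤ.* pw p j
      q-spec n = _∣_.equality (pʲ∣ n)
      q-coherent : ∀ n → pw p n ∣ (q (suc n) ℤ.- q n)
      q-coherent n = *-cancelʳ-∣ (pw p j) {{pw-nonZero j}} (subst₂ _∣_ (pw-+ n j)
        (trans (cong₂ ℤ._-_ (q-spec (suc n)) (q-spec n)) (x*k-y*k≡[x-y]*k (q (suc n)) (q n) (pw p j))) (coh a (n ℕ.+ j)))
      a≈pʲq : ∀ n → pw p n ∣ (seq a n ℤ.- pw p j ℤ.* q n)
      a≈pʲq n = subst (pw p n ∣_)
        (trans (sym (y-x≡-[x-y] (seq a (n ℕ.+ j)) (seq a n))) (cong (λ t → seq a n ℤ.- t) (trans (q-spec n) (ℤ.*-comm (q n) (pw p j)))))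
        (∣m⇒∣-m (subst (λ t → pw p n ∣ seq a t ℤ.- seq a n) (ℕ.+-comm j n) (seq-coherent a n j)))

    p^∣⇒pw∣seq : ∀ j a → p^[ j ]∣ a → pw p j ∣ seq a j
    p^∣⇒pw∣seq j a (c , mk≈z e) = subst (pw p j ∣_) (sym (x≡x-y+y (seq a j) (pw p j ℤ.* seq c j)))
      (∣m∣n⇒∣m+n (e j) (∣m⇒∣m*n (seq c j) ∣-refl))

    p^[0]∣ : ∀ a → p^[ 0 ]∣ a
    p^[0]∣ a = a , ≈z-pointwise (λ n → sym (ℤ.*-identityˡ (seq a n)))

  p^[_]∣? : ∀ j a → Dec (p^[ j ]∣ a)
  p^[ j ]∣? a = map′ (pw∣seq⇒p^∣ j a) (p^∣⇒pw∣seq j a) (pw p j ∣? seq a j)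

  p^-suc : ∀ j → p^ (suc j) ≈z p^ j *ₚ p^ 1
  p^-suc j = subst (λ t → p^ t ≈z p^ j *ₚ p^ 1) (ℕ.+-comm j 1) (p^-+ j 1)

  p^[suc]∣ : ∀ j {a c} → a ≈z p^ j *ₚ c → p^[ 1 ]∣ c → p^[ suc j ]∣ a
  p^[suc]∣ j {a} {c} a≈pʲc (d , c≈pd) = d , (begin
    a                       ≈⟨ a≈pʲc ⟩
    p^ j *ₚ c               ≈⟨ *-congˡ c≈pd ⟩
    p^ j *ₚ (p^ 1 *ₚ d)     ≈⟨ *-assoc (p^ j) (p^ 1) d ⟨
    (p^ j *ₚ p^ 1) *ₚ d     ≈⟨ *-congʳ (p^-suc j) ⟨
    p^ (suc j) *ₚ d         ∎)
    where open ≈z-Reasoning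

  pw-suc : ∀ n → pw p (suc n) ≡ pw p n ℤ.* + p
  pw-suc n = trans (cong +_ (ℕ.*-comm p (p ℕ.^ n))) (ℤ.pos-* (p ℕ.^ n) p)

  pw-one : pw p 1 ≡ + p
  pw-one = cong +_ (ℕ.*-identityʳ p)

  p∤1 : ¬ (+ p ∣ + 1)
  p∤1 p∣1 = ℕ.nonTrivial⇒≢1 {{prime⇒nonTrivial p-prime}} (ℕ.∣1⇒≡1 (∣⇒∣ᵤ p∣1))

  opaque
    unfolding p^_ _+ₚ_
    IsUnit⇒p∤seq : ∀ {u} → IsUnit u → ∀ n → ¬ (+ p ∣ seq u (suc n))
    IsUnit⇒p∤seq {u} (v , mk≈z uv≈1) n p∣uₙ₊₁ = p∤1 (subst (+ p ∣_) (sym (1≡xy-[xy-1] (seq u (suc n)) (seq v (suc n))))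
      (∣m∣n⇒∣m-n (∣m⇒∣m*n (seq v (suc n)) p∣uₙ₊₁) (∣-trans (divides (pw p n) (pw-suc n)) (uv≈1 (suc n)))))
      where
      1≡xy-[xy-1] : ∀ x y → + 1 ≡ x ℤ.* y ℤ.- (x ℤ.* y ℤ.- + 1)
      1≡xy-[xy-1] = solve 2 (λ x y → con (+ 1) := x :* y :- (x :* y :- con (+ 1))) refl

    -- If j > i then level i + 1 of the hypothesis makes p divide u.
    p^*unit≈p^*⇒≤ : ∀ i j {u c} → IsUnit u → p^ i *ₚ u ≈z p^ j *ₚ c → j ≤ i
    p^*unit≈p^*⇒≤ i j {u} {c} unit (mk≈z e) = decide (j ℕ.≤? i)
      where
      decide : Dec (j ≤ i) → j ≤ i
      decide (yes j≤i) = j≤i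
      decide (no  j≰i) = contradiction p∣uᵢ₊₁ (IsUnit⇒p∤seq unit i)
        where
        A B : ℤ
        A = pw p i ℤ.* seq u (suc i)
        B = pw p j ℤ.* seq c (suc i)
        pⁱ⁺¹∣B : pw p (suc i) ∣ B
        pⁱ⁺¹∣B = ∣m⇒∣m*n (seq c (suc i))
          (subst (λ t → pw p (suc i) ∣ pw p t) (ℕ.m∸n+n≡m (ℕ.≰⇒> j≰i)) (pw∣pw (suc i) (j ℕ.∸ suc i)))
        pⁱ⁺¹∣A : pw p (suc i) ∣ A
        pⁱ⁺¹∣A = subst (pw p (suc i) ∣_) (sym (x≡x-y+y A B)) (∣m∣n⇒∣m+n (e (suc i)) pⁱ⁺¹∣B)
        p∣uᵢ₊₁ : + p ∣ seq u (suc i)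
        p∣uᵢ₊₁ = *-cancelˡ-∣ (pw p i) {{pw-nonZero i}} (subst (_∣ A) (pw-suc i) pⁱ⁺¹∣A)

  p^∣-bound : ∀ {a w F j} → a *ₚ w ≈z p^ F → p^[ j ]∣ a → j ≤ F
  p^∣-bound {a} {w} {F} {j} aw≈pᶠ (c , a≈pʲc) = p^*unit≈p^*⇒≤ F j IsUnit-1 (begin
    p^ F *ₚ 1ₚ              ≈⟨ *-identityʳ (p^ F) ⟩
    p^ F                    ≈⟨ aw≈pᶠ ⟨
    a *ₚ w                  ≈⟨ *-congʳ a≈pʲc ⟩
    (p^ j *ₚ c) *ₚ w        ≈⟨ *-assoc (p^ j) c w ⟩
    p^ j *ₚ (c *ₚ w)        ∎)
    where open ≈z-Reasoning

  inverse-mod-p : ∀ x → ¬ (+ p ∣ x) → Σ ℤ λ e → + p ∣ (x ℤ.* e ℤ.- + 1)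
  inverse-mod-p (+ m)    p∤x = inverse-modℕ m p∤x
    where
    coprime : ∀ {m} → ¬ (+ p ∣ + m) → Coprime p m
    coprime p∤m {d} (d∣p , d∣m) with prime⇒irreducible p-prime d∣p
    ... | inj₁ d≡1  = d≡1
    ... | inj₂ refl = contradiction (∣ᵤ⇒∣ d∣m) p∤m
    pos-1+* : ∀ a b → + (1 ℕ.+ a ℕ.* b) ≡ + 1 ℤ.+ + a ℤ.* + b
    pos-1+* a b = trans (ℤ.pos-+ 1 (a ℕ.* b)) (cong (λ t → + 1 ℤ.+ t) (ℤ.pos-* a b))
    inverse-modℕ : ∀ m → ¬ (+ p ∣ + m) → Σ ℤ λ e → + p ∣ (+ m ℤ.* e ℤ.- + 1)
    inverse-modℕ m p∤m with coprime-Bézout (coprime p∤m)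
    ... | ℕ.Bézout.+- a b 1+bm≡ap = ℤ.- + b , divides (ℤ.- + a)
            (rearrange (+ a) (+ b) (+ m) (+ p) (trans (sym (pos-1+* b m)) (trans (cong +_ 1+bm≡ap) (ℤ.pos-* a p))))
      where
      rearrange : ∀ a b m p → + 1 ℤ.+ b ℤ.* m ≡ a ℤ.* p → m ℤ.* (ℤ.- b) ℤ.- + 1 ≡ (ℤ.- a) ℤ.* p
      rearrange a b m p eq = trans (solve 3 (λ b m one → m :* (:- b) :- one := :- (one :+ b :* m)) refl b m (+ 1))
                                   (trans (cong ℤ.-_ eq) (ℤ.neg-distribˡ-* a p))
    ... | ℕ.Bézout.-+ a b 1+ap≡bm = + b , divides (+ a)
            (rearrange (+ a) (+ b) (+ m) (+ p) (trans (sym (pos-1+* a p)) (trans (cong +_ 1+ap≡bm) (ℤ.pos-* b m))))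
      where
      rearrange : ∀ a b m p → + 1 ℤ.+ a ℤ.* p ≡ b ℤ.* m → m ℤ.* b ℤ.- + 1 ≡ a ℤ.* p
      rearrange a b m p eq = trans (cong (λ t → t ℤ.- + 1) (trans (ℤ.*-comm m b) (sym eq)))
                                   (solve 2 (λ ap one → one :+ ap :- one := ap) refl (a ℤ.* p) (+ 1))
  inverse-mod-p -[1+ n ] p∤x with inverse-mod-p (+ suc n) (λ p∣n → p∤x (∣m⇒∣-m p∣n))
  ... | e , p∣ne-1 = ℤ.- e , subst (+ p ∣_) (sym (neg-neg (+ suc n) e)) p∣ne-1
    where
    neg-neg : ∀ m e → (ℤ.- m) ℤ.* (ℤ.- e) ℤ.- + 1 ≡ m ℤ.* e ℤ.- + 1
    neg-neg = solve 2 (λ m e → (:- m) :* (:- e) :- con (+ 1) := m :* e :- con (+ 1)) refl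

  geometricSum : ℤ → ℕ → ℤ
  geometricSum x zero    = + 0
  geometricSum x (suc n) = geometricSum x n ℤ.+ x ℤ.^ n

  geometricSum-telescopes : ∀ x n → (+ 1 ℤ.- x) ℤ.* geometricSum x n ≡ + 1 ℤ.- x ℤ.^ n
  geometricSum-telescopes x zero    = solve 1 (λ x → (con (+ 1) :- x) :* con (+ 0) := con (+ 1) :- con (+ 1)) refl x
  geometricSum-telescopes x (suc n) = begin
    (+ 1 ℤ.- x) ℤ.* (geometricSum x n ℤ.+ x ℤ.^ n)
      ≡⟨ expand x (geometricSum x n) (x ℤ.^ n) ⟩
    (+ 1 ℤ.- x) ℤ.* geometricSum x n ℤ.+ x ℤ.^ n ℤ.- x ℤ.* x ℤ.^ n
      ≡⟨ cong (λ t → t ℤ.+ x ℤ.^ n ℤ.- x ℤ.* x ℤ.^ n) (geometricSum-telescopes x n) ⟩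
    + 1 ℤ.- x ℤ.^ n ℤ.+ x ℤ.^ n ℤ.- x ℤ.* x ℤ.^ n
      ≡⟨ cancel x (x ℤ.^ n) ⟩
    + 1 ℤ.- x ℤ.* x ℤ.^ n ∎
    where
    open ≡-Reasoning
    expand : ∀ x g y → (+ 1 ℤ.- x) ℤ.* (g ℤ.+ y) ≡ (+ 1 ℤ.- x) ℤ.* g ℤ.+ y ℤ.- x ℤ.* y
    expand = solve 3 (λ x g y → (con (+ 1) :- x) :* (g :+ y) := (con (+ 1) :- x) :* g :+ y :- x :* y) refl
    cancel : ∀ x y → + 1 ℤ.- y ℤ.+ y ℤ.- x ℤ.* y ≡ + 1 ℤ.- x ℤ.* y
    cancel = solve 2 (λ x y → con (+ 1) :- y :+ y :- x :* y := con (+ 1) :- x :* y) refl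

  x-y∣xⁿ-yⁿ : ∀ x y n → (x ℤ.- y) ∣ (x ℤ.^ n ℤ.- y ℤ.^ n)
  x-y∣xⁿ-yⁿ x y zero    = subst ((x ℤ.- y) ∣_) (sym (ℤ.+-inverseʳ (+ 1))) (∣0 (x ℤ.- y))
  x-y∣xⁿ-yⁿ x y (suc n) = subst ((x ℤ.- y) ∣_) (sym (split x y (x ℤ.^ n) (y ℤ.^ n)))
    (∣m∣n⇒∣m+n (∣n⇒∣m*n x (x-y∣xⁿ-yⁿ x y n)) (∣m⇒∣m*n (y ℤ.^ n) ∣-refl))
    where
    split : ∀ x y X Y → x ℤ.* X ℤ.- y ℤ.* Y ≡ x ℤ.* (X ℤ.- Y) ℤ.+ (x ℤ.- y) ℤ.* Y
    split = solve 4 (λ x y X Y → x :* X :- y :* Y := x :* (X :- Y) :+ (x :- y) :* Y) refl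

  x-y∣geometricSum-diff : ∀ x y n → (x ℤ.- y) ∣ (geometricSum x n ℤ.- geometricSum y n)
  x-y∣geometricSum-diff x y zero    = ∣0 (x ℤ.- y)
  x-y∣geometricSum-diff x y (suc n) =
    subst ((x ℤ.- y) ∣_) (sym (+-diff (geometricSum x n) (geometricSum y n) (x ℤ.^ n) (y ℤ.^ n)))
      (∣m∣n⇒∣m+n (x-y∣geometricSum-diff x y n) (x-y∣xⁿ-yⁿ x y n))

  p∣x⇒pwⁿ∣xⁿ : ∀ {x} n → + p ∣ x → pw p n ∣ (x ℤ.^ n)
  p∣x⇒pwⁿ∣xⁿ {x} zero    _                = ∣-refl
  p∣x⇒pwⁿ∣xⁿ {x} (suc n) p∣x@(divides q x≡qp) with p∣x⇒pwⁿ∣xⁿ n p∣x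
  ... | divides q′ xⁿ≡q′pⁿ = divides (q ℤ.* q′) (begin
    x ℤ.* x ℤ.^ n                          ≡⟨ cong₂ ℤ._*_ x≡qp xⁿ≡q′pⁿ ⟩
    (q ℤ.* + p) ℤ.* (q′ ℤ.* pw p n)        ≡⟨ regroup q (+ p) q′ (pw p n) ⟩
    (q ℤ.* q′) ℤ.* (pw p n ℤ.* + p)        ≡⟨ cong ((q ℤ.* q′) ℤ.*_) (pw-suc n) ⟨
    (q ℤ.* q′) ℤ.* pw p (suc n)            ∎)
    where
    open ≡-Reasoning
    regroup : ∀ q p q′ w → (q ℤ.* p) ℤ.* (q′ ℤ.* w) ≡ (q ℤ.* q′) ℤ.* (w ℤ.* p)
    regroup = solve 4 (λ q p q′ w → (q :* p) :* (q′ :* w) := (q :* q′) :* (w :* p)) refl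

  opaque
    unfolding _+ₚ_
    -- With e ≡ c⁻¹ (mod p), t = 1 − ce is divisible by p, and e(1 + t + ⋯ + tⁿ⁻¹) inverts c modulo pⁿ
    -- because ce(1 + t + ⋯ + tⁿ⁻¹) = (1 − t)(1 + t + ⋯ + tⁿ⁻¹) = 1 − tⁿ.
    p∤seq₁⇒IsUnit : ∀ c → ¬ (+ p ∣ seq c 1) → IsUnit c
    p∤seq₁⇒IsUnit c p∤c₁ = c⁻¹ , mk≈z cc⁻¹≡1
      where
      e : ℤ
      e = proj₁ (inverse-mod-p (seq c 1) p∤c₁)
      p∣c₁e-1 : + p ∣ (seq c 1 ℤ.* e ℤ.- + 1)
      p∣c₁e-1 = proj₂ (inverse-mod-p (seq c 1) p∤c₁)
      t : ℤₚ
      t = 1ᶻ +ᶻ (-ᶻ (c *ᶻ ιᶻ e))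
      p∣t : ∀ n → + p ∣ seq t (suc n)
      p∣t n = subst (+ p ∣_) (sym (regroup (seq c (suc n)) (seq c 1) e))
        (∣m⇒∣-m (∣m∣n⇒∣m+n (∣m⇒∣m*n e p∣cₙ₊₁-c₁) p∣c₁e-1))
        where
        p∣cₙ₊₁-c₁ : + p ∣ (seq c (suc n) ℤ.- seq c 1)
        p∣cₙ₊₁-c₁ = subst₂ (λ a b → a ∣ (seq c b ℤ.- seq c 1)) pw-one (ℕ.+-comm n 1) (seq-coherent c 1 n)
        regroup : ∀ C C₁ e → + 1 ℤ.+ ℤ.- (C ℤ.* e) ≡ ℤ.- ((C ℤ.- C₁) ℤ.* e ℤ.+ (C₁ ℤ.* e ℤ.- + 1))
        regroup = solve 3 (λ C C₁ e → con (+ 1) :+ :- (C :* e) := :- ((C :- C₁) :* e :+ (C₁ :* e :- con (+ 1)))) refl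
      c⁻¹-coherent : ∀ n → pw p n ∣ (e ℤ.* geometricSum (seq t (suc n)) (suc n) ℤ.- e ℤ.* geometricSum (seq t n) n)
      c⁻¹-coherent n = subst (pw p n ∣_) (sym (regroup e (geometricSum tₙ₊₁ n) (geometricSum (seq t n) n) (tₙ₊₁ ℤ.^ n)))
        (∣n⇒∣m*n e (∣m∣n⇒∣m+n (p∣x⇒pwⁿ∣xⁿ n (p∣t n))
                              (∣-trans (coh t n) (x-y∣geometricSum-diff tₙ₊₁ (seq t n) n))))
        where
        tₙ₊₁ : ℤ
        tₙ₊₁ = seq t (suc n)
        regroup : ∀ e g₁ g₀ y → e ℤ.* (g₁ ℤ.+ y) ℤ.- e ℤ.* g₀ ≡ e ℤ.* (y ℤ.+ (g₁ ℤ.- g₀))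
        regroup = solve 4 (λ e g₁ g₀ y → e :* (g₁ :+ y) :- e :* g₀ := e :* (y :+ (g₁ :- g₀))) refl
      c⁻¹ : ℤₚ
      c⁻¹ = mkℤp (λ n → e ℤ.* geometricSum (seq t n) n) c⁻¹-coherent
      pwⁿ∣tⁿ : ∀ n → pw p n ∣ (seq t n ℤ.^ n)
      pwⁿ∣tⁿ zero    = ∣-refl
      pwⁿ∣tⁿ (suc n) = p∣x⇒pwⁿ∣xⁿ (suc n) (p∣t n)
      cc⁻¹≡1 : ∀ n → pw p n ∣ (seq c n ℤ.* (e ℤ.* geometricSum (seq t n) n) ℤ.- + 1)
      cc⁻¹≡1 n = subst (pw p n ∣_)
        (sym (trans (regroup (seq c n) e (geometricSum (seq t n) n))
                    (trans (cong (λ q → q ℤ.- + 1) (geometricSum-telescopes (seq t n) n)) (cancel (seq t n ℤ.^ n)))))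
        (∣m⇒∣-m (pwⁿ∣tⁿ n))
        where
        regroup : ∀ C e G → C ℤ.* (e ℤ.* G) ℤ.- + 1 ≡ (+ 1 ℤ.- (+ 1 ℤ.+ ℤ.- (C ℤ.* e))) ℤ.* G ℤ.- + 1
        regroup = solve 3 (λ C e G → C :* (e :* G) :- con (+ 1)
                                     := (con (+ 1) :- (con (+ 1) :+ :- (C :* e))) :* G :- con (+ 1)) refl
        cancel : ∀ y → (+ 1 ℤ.- y) ℤ.- + 1 ≡ ℤ.- y
        cancel = solve 1 (λ y → (con (+ 1) :- y) :- con (+ 1) := :- y) refl

  ¬p^[1]∣⇒IsUnit : ∀ c → ¬ p^[ 1 ]∣ c → IsUnit c
  ¬p^[1]∣⇒IsUnit c ¬p∣c = p∤seq₁⇒IsUnit c (λ p∣c₁ → ¬p∣c (pw∣seq⇒p^∣ 1 c (subst (_∣ seq c 1) (sym pw-one) p∣c₁)))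

  find-boundary : ∀ {P : ℕ → Set} → (∀ j → Dec (P j)) → P 0 → ∀ m → ¬ P m → Σ ℕ λ j → P j × ¬ P (suc j)
  find-boundary P? P0 zero    ¬P0   = contradiction P0 ¬P0
  find-boundary P? P0 (suc m) ¬Pm+1 with P? m
  ... | yes Pm  = m , Pm , ¬Pm+1
  ... | no  ¬Pm = find-boundary P? P0 m ¬Pm

  ∣p^⇒p^*unit : ∀ {a w F} → a *ₚ w ≈z p^ F → Σ ℕ λ r → Σ ℤₚ λ t → IsUnit t × a ≈z p^ r *ₚ t
  ∣p^⇒p^*unit {a} {w} {F} aw≈pᶠ
    with find-boundary (λ j → p^[ j ]∣? a) (p^[0]∣ a) (suc F) (λ p^ᶠ⁺¹∣a → ℕ.n≮n F (p^∣-bound aw≈pᶠ p^ᶠ⁺¹∣a))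
  ... | j , (c , a≈pʲc) , ¬p^ʲ⁺¹∣a = j , c , ¬p^[1]∣⇒IsUnit c (λ p∣c → ¬p^ʲ⁺¹∣a (p^[suc]∣ j a≈pʲc p∣c)) , a≈pʲc

  p^*unit-unique : ∀ {G₁ G₂ u v} → IsUnit u → IsUnit v → p^ G₁ *ₚ u ≈z p^ G₂ *ₚ v → G₁ ≡ G₂ × u ≈z v
  p^*unit-unique {G₁} {G₂} {u} {v} u-unit v-unit pᴳ¹u≈pᴳ²v = G₁≡G₂ , *-p^-cancelʳ G₁ (begin
    u *ₚ p^ G₁      ≈⟨ *-comm u (p^ G₁) ⟩
    p^ G₁ *ₚ u      ≈⟨ pᴳ¹u≈pᴳ²v ⟩
    p^ G₂ *ₚ v      ≡⟨ cong (λ g → p^ g *ₚ v) G₁≡G₂ ⟨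
    p^ G₁ *ₚ v      ≈⟨ *-comm (p^ G₁) v ⟩
    v *ₚ p^ G₁      ∎)
    where
    open ≈z-Reasoning
    G₁≡G₂ : G₁ ≡ G₂
    G₁≡G₂ = ℕ.≤-antisym (p^*unit≈p^*⇒≤ G₂ G₁ v-unit (≈z-sym pᴳ¹u≈pᴳ²v)) (p^*unit≈p^*⇒≤ G₁ G₂ u-unit pᴳ¹u≈pᴳ²v)

module SmithNormalForm (p : ℕ) (p-prime : Prime p) where

  open import Data.Nat.Base as ℕ using (suc; _≤_)
  import Data.Nat.Properties as ℕ
  open import Data.Product.Base using (Σ; _×_; _,_)
  open import Data.Sum.Base using (_⊎_; inj₁; inj₂)
  open import Relation.Nullary using (¬_; Dec; yes; no; contradiction)
  open import Relation.Nullary.Decidable using (_×-dec_)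
  open import Algebra.Bundles using (CommutativeRing)
  open import Defs using (mat; m₁₁; m₁₂; m₂₁; m₂₂)

  open PAdicIntegers p p-prime
  open Matrix₂ ℤₚ-ring
  open CommutativeRingUnits ℤₚ-ring using (IsUnit)
  open CommutativeRing ℤₚ-ring using (refl; *-congˡ; *-congʳ; *-assoc; *-identityʳ; *-commutativeSemigroup)
  open import Algebra.Properties.CommutativeSemigroup *-commutativeSemigroup using (x∙yz≈yx∙z)

  infix 4 p^[_]∣ₘ_
  p^[_]∣ₘ_ : ℕ → Mat → Set
  p^[ j ]∣ₘ N = p^[ j ]∣ m₁₁ N × p^[ j ]∣ m₁₂ N × p^[ j ]∣ m₂₁ N × p^[ j ]∣ m₂₂ N

  p^[_]∣ₘ? : ∀ j N → Dec (p^[ j ]∣ₘ N)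
  p^[ j ]∣ₘ? N = p^[ j ]∣? (m₁₁ N) ×-dec p^[ j ]∣? (m₁₂ N) ×-dec p^[ j ]∣? (m₂₁ N) ×-dec p^[ j ]∣? (m₂₂ N)

  p^[0]∣ₘ : ∀ N → p^[ 0 ]∣ₘ N
  p^[0]∣ₘ N = p^[0]∣ _ , p^[0]∣ _ , p^[0]∣ _ , p^[0]∣ _

  quotient : ∀ {j N} → p^[ j ]∣ₘ N → Mat
  quotient ((a , _) , (b , _) , (c , _) , (d , _)) = mat a b c d

  ≋-scale-quotient : ∀ {j N} (q : p^[ j ]∣ₘ N) → N ≋ scale (p^ j) (quotient q)
  ≋-scale-quotient ((_ , ea) , (_ , eb) , (_ , ec) , (_ , ed)) = mk≋ ea eb ec ed

  determinant-quotient : ∀ {j N} (q : p^[ j ]∣ₘ N) → determinant N ≈z p^ (j ℕ.+ j) *ₚ determinant (quotient q)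
  determinant-quotient {j} {N} q = begin
    determinant N                                     ≈⟨ determinant-cong (≋-scale-quotient q) ⟩
    determinant (scale (p^ j) (quotient q))           ≈⟨ determinant-scale (p^ j) (quotient q) ⟩
    (p^ j *ₚ p^ j) *ₚ determinant (quotient q)        ≈⟨ *-congʳ (p^-+ j j) ⟨
    p^ (j ℕ.+ j) *ₚ determinant (quotient q)          ∎
    where open ≈z-Reasoning

  p^∣ₘ-bound : ∀ {N w F j} → determinant N *ₚ w ≈z p^ F → p^[ j ]∣ₘ N → j ℕ.+ j ≤ F
  p^∣ₘ-bound {N} {w} {F} {j} det-N*w≈pᶠ q = p^∣-bound pᶠ≈ (determinant (quotient q) *ₚ w , refl)
    where
    open ≈z-Reasoning
    pᶠ≈ : (p^ (j ℕ.+ j) *ₚ (determinant (quotient q) *ₚ w)) *ₚ 1ₚ ≈z p^ F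
    pᶠ≈ = begin
      (p^ (j ℕ.+ j) *ₚ (determinant (quotient q) *ₚ w)) *ₚ 1ₚ  ≈⟨ *-identityʳ _ ⟩
      p^ (j ℕ.+ j) *ₚ (determinant (quotient q) *ₚ w)          ≈⟨ *-assoc _ _ w ⟨
      (p^ (j ℕ.+ j) *ₚ determinant (quotient q)) *ₚ w          ≈⟨ *-congʳ (determinant-quotient q) ⟨
      determinant N *ₚ w                                       ≈⟨ det-N*w≈pᶠ ⟩
      p^ F                                                     ∎

  -- For the largest such j, some entry of the quotient is prime to p and hence a unit.
  quotient-SL₂Diagonalisable : ∀ {j N} (q : p^[ j ]∣ₘ N) → ¬ p^[ suc j ]∣ₘ N → SL₂Diagonalisable (quotient q)
  quotient-SL₂Diagonalisable {j} ((a , ea) , (b , eb) , (c , ec) , (d , ed)) ¬p^ʲ⁺¹∣N =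
    unit-entry⇒SL₂Diagonalisable (mat a b c d) (some-unit (p^[ 1 ]∣? a) (p^[ 1 ]∣? b) (p^[ 1 ]∣? c) (p^[ 1 ]∣? d))
    where
    some-unit : Dec (p^[ 1 ]∣ a) → Dec (p^[ 1 ]∣ b) → Dec (p^[ 1 ]∣ c) → Dec (p^[ 1 ]∣ d) →
                IsUnit a ⊎ IsUnit b ⊎ IsUnit c ⊎ IsUnit d
    some-unit (no ¬p∣a) _         _         _         = inj₁ (¬p^[1]∣⇒IsUnit a ¬p∣a)
    some-unit (yes _)   (no ¬p∣b) _         _         = inj₂ (inj₁ (¬p^[1]∣⇒IsUnit b ¬p∣b))
    some-unit (yes _)   (yes _)   (no ¬p∣c) _         = inj₂ (inj₂ (inj₁ (¬p^[1]∣⇒IsUnit c ¬p∣c)))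
    some-unit (yes _)   (yes _)   (yes _)   (no ¬p∣d) = inj₂ (inj₂ (inj₂ (¬p^[1]∣⇒IsUnit d ¬p∣d)))
    some-unit (yes p∣a) (yes p∣b) (yes p∣c) (yes p∣d) =
      contradiction (p^[suc]∣ j ea p∣a , p^[suc]∣ j eb p∣b , p^[suc]∣ j ec p∣c , p^[suc]∣ j ed p∣d) ¬p^ʲ⁺¹∣N

  record SmithForm (N : Mat) : Set where
    field
      exponent gap      : ℕ
      unit              : ℤₚ
      unit-isUnit       : IsUnit unit
      left right        : Mat
      determinant-left  : determinant left ≈z 1ₚ
      determinant-right : determinant right ≈z 1ₚ
      decomposition     : N ≋ (left ⊙ diag (p^ exponent) (p^ (exponent ℕ.+ gap) *ₚ unit)) ⊙ right

  smithNormalForm : ∀ {N w F} → determinant N *ₚ w ≈z p^ F → SmithForm N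
  smithNormalForm {N} {w} {F} det-N*w≈pᶠ = atBoundary (find-boundary (λ j → p^[ j ]∣ₘ? N) (p^[0]∣ₘ N) (suc F)
    (λ p^ᶠ⁺¹∣N → ℕ.n≮n F (ℕ.≤-trans (ℕ.m≤m+n (suc F) (suc F)) (p^∣ₘ-bound det-N*w≈pᶠ p^ᶠ⁺¹∣N))))
    where
    atBoundary : (Σ ℕ λ j → p^[ j ]∣ₘ N × ¬ p^[ suc j ]∣ₘ N) → SmithForm N
    atBoundary (j , q , ¬p^ʲ⁺¹∣N) = smithForm (quotient-SL₂Diagonalisable q ¬p^ʲ⁺¹∣N) (∣p^⇒p^*unit det-C*w′≈pᶠ)
      where
      C = quotient q
      det-C*w′≈pᶠ : determinant C *ₚ ((p^ j *ₚ p^ j) *ₚ w) ≈z p^ F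
      det-C*w′≈pᶠ = begin
        determinant C *ₚ ((p^ j *ₚ p^ j) *ₚ w)      ≈⟨ x∙yz≈yx∙z _ _ w ⟩
        ((p^ j *ₚ p^ j) *ₚ determinant C) *ₚ w      ≈⟨ *-congʳ (*-congʳ (p^-+ j j)) ⟨
        (p^ (j ℕ.+ j) *ₚ determinant C) *ₚ w        ≈⟨ *-congʳ (determinant-quotient q) ⟨
        determinant N *ₚ w                          ≈⟨ det-N*w≈pᶠ ⟩
        p^ F                                        ∎
        where open ≈z-Reasoning
      smithForm : SL₂Diagonalisable C → (Σ ℕ λ i → Σ ℤₚ λ u → IsUnit u × determinant C ≈z p^ i *ₚ u) → SmithForm N
      smithForm (A , B , det-A , det-B , C≋) (i , u , u-unit , det-C≈) = record
        { exponent = j ; gap = i ; unit = u ; unit-isUnit = u-unit ; left = A ; right = B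
        ; determinant-left = det-A ; determinant-right = det-B ; decomposition = N≋ }
        where
        p^ʲdet-C≈ : p^ j *ₚ determinant C ≈z p^ (j ℕ.+ i) *ₚ u
        p^ʲdet-C≈ = begin
          p^ j *ₚ determinant C       ≈⟨ *-congˡ det-C≈ ⟩
          p^ j *ₚ (p^ i *ₚ u)         ≈⟨ *-assoc (p^ j) (p^ i) u ⟨
          (p^ j *ₚ p^ i) *ₚ u         ≈⟨ *-congʳ (p^-+ j i) ⟨
          p^ (j ℕ.+ i) *ₚ u           ∎
          where open ≈z-Reasoning
        N≋ : N ≋ (A ⊙ diag (p^ j) (p^ (j ℕ.+ i) *ₚ u)) ⊙ B
        N≋ = begin
          N                                                      ≈⟨ ≋-scale-quotient q ⟩
          scale (p^ j) C                                         ≈⟨ scale-cong (p^ j) C≋ ⟩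
          scale (p^ j) ((A ⊙ diag 1ₚ (determinant C)) ⊙ B)       ≈⟨ scale-⊙diag⊙ (p^ j) 1ₚ (determinant C) A B ⟩
          (A ⊙ diag (p^ j *ₚ 1ₚ) (p^ j *ₚ determinant C)) ⊙ B    ≈⟨ ⊙-congʳ (⊙-congˡ (diag-cong (*-identityʳ (p^ j)) p^ʲdet-C≈)) ⟩
          (A ⊙ diag (p^ j) (p^ (j ℕ.+ i) *ₚ u)) ⊙ B              ∎
          where open ≋-Reasoning

module PAdicNumbers (p : ℕ) (p-prime : Prime p) where

  open import Data.Nat.Base as ℕ using (suc)
  import Relation.Binary.Reasoning.Setoid
  import Data.Nat.Properties as ℕ
  open import Data.Integer.Base as ℤ using (ℤ; +_; -[1+_]; _≤_)
  open import Data.Nat.Base using () renaming (_≤_ to _≤ℕ_)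
  import Data.Integer.Properties as ℤ
  open import Data.Integer.Divisibility.Signed
  open import Data.Integer.Solver using (module +-*-Solver)
  open import Data.Product.Base using (_,_)
  open import Relation.Binary.PropositionalEquality.Core using (_≡_; refl; subst; subst₂; sym; trans; cong; cong₂)
  open import Relation.Binary.PropositionalEquality using (module ≡-Reasoning)
  open import Algebra.Bundles using (CommutativeRing)
  open import Algebra.Structures using (IsCommutativeRing)
  open import Level using (0ℓ)
  open import Defs

  open PAdicIntegers p p-prime
  open CommutativeRingUnits ℤₚ-ring using (IsUnit-1) renaming (IsUnit to IsUnitₚ)
  open +-*-Solver

  ℚₚ : Set
  ℚₚ = ℚp p

  infix 4 _≈q_
  record _≈q_ (x y : ℚₚ) : Set where
    constructor mk≈q
    field un≈q : x ≈ y
  open _≈q_ public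

  numₙ : ℚₚ → ℕ → ℤ
  numₙ x n = seq (num x) n

  ≈q-pointwise : ∀ {x y} → (∀ n → numₙ x n ℤ.* pw p (den y) ≡ numₙ y n ℤ.* pw p (den x)) → x ≈q y
  ≈q-pointwise {x} {y} e = mk≈q (un≈z (≈z-pointwise {num x *ᶻ ιᶻ (pw p (den y))} {num y *ᶻ ιᶻ (pw p (den x))} e))

  ≈q-refl : ∀ {x} → x ≈q x
  ≈q-refl = ≈q-pointwise (λ _ → refl)

  ≈q-sym : ∀ {x y} → x ≈q y → y ≈q x
  ≈q-sym {x} {y} (mk≈q e) = mk≈q (un≈z (≈z-sym {num x *ᶻ ιᶻ (pw p (den y))} {num y *ᶻ ιᶻ (pw p (den x))} (mk≈z e)))

  +q-assoc : ∀ x y z → ((x +q y) +q z) ≈q (x +q (y +q z))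
  +q-assoc x y z = ≈q-pointwise λ n → eqn′ (numₙ x n) (numₙ y n) (numₙ z n) (pw p (den x)) (pw p (den y)) (pw p (den z))
      _ _ _ _ (pw-+ (den x) (den y)) (pw-+ (den y) (den z)) (pw-+ (den x) (den y ℕ.+ den z)) (pw-+ (den x ℕ.+ den y) (den z))
    where
    eqn : ∀ X Y Z a b c → ((X ℤ.* b ℤ.+ Y ℤ.* a) ℤ.* c ℤ.+ Z ℤ.* (a ℤ.* b)) ℤ.* (a ℤ.* (b ℤ.* c)) ≡ (X ℤ.* (b ℤ.* c) ℤ.+ (Y ℤ.* c ℤ.+ Z ℤ.* b) ℤ.* a) ℤ.* ((a ℤ.* b) ℤ.* c)
    eqn = solve 6 (λ X Y Z a b c → ((X :* b :+ Y :* a) :* c :+ Z :* (a :* b)) :* (a :* (b :* c)) := (X :* (b :* c) :+ (Y :* c :+ Z :* b) :* a) :* ((a :* b) :* c)) refl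
    eqn′ : ∀ X Y Z a b c ab bc a-bc ab-c → ab ≡ a ℤ.* b → bc ≡ b ℤ.* c → a-bc ≡ a ℤ.* bc → ab-c ≡ ab ℤ.* c →
      ((X ℤ.* b ℤ.+ Y ℤ.* a) ℤ.* c ℤ.+ Z ℤ.* ab) ℤ.* a-bc ≡ (X ℤ.* bc ℤ.+ (Y ℤ.* c ℤ.+ Z ℤ.* b) ℤ.* a) ℤ.* ab-c
    eqn′ X Y Z a b c _ _ _ _ refl refl refl refl = eqn X Y Z a b c

  +q-comm : ∀ x y → (x +q y) ≈q (y +q x)
  +q-comm x y = ≈q-pointwise λ n → eqn′ (numₙ x n) (numₙ y n) (pw p (den x)) (pw p (den y)) _ _ (pw-+ (den x) (den y)) (pw-+ (den y) (den x))
    where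
    eqn : ∀ X Y a b → (X ℤ.* b ℤ.+ Y ℤ.* a) ℤ.* (b ℤ.* a) ≡ (Y ℤ.* a ℤ.+ X ℤ.* b) ℤ.* (a ℤ.* b)
    eqn = solve 4 (λ X Y a b → (X :* b :+ Y :* a) :* (b :* a) := (Y :* a :+ X :* b) :* (a :* b)) refl
    eqn′ : ∀ X Y a b ab ba → ab ≡ a ℤ.* b → ba ≡ b ℤ.* a → (X ℤ.* b ℤ.+ Y ℤ.* a) ℤ.* ba ≡ (Y ℤ.* a ℤ.+ X ℤ.* b) ℤ.* ab
    eqn′ X Y a b _ _ refl refl = eqn X Y a b

  +q-identityˡ : ∀ x → (0q +q x) ≈q x
  +q-identityˡ x = ≈q-pointwise λ n → eqn (numₙ x n) (pw p (den x))
    where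
    eqn : ∀ X a → (+ 0 ℤ.* a ℤ.+ X ℤ.* + 1) ℤ.* a ≡ X ℤ.* a
    eqn = solve 2 (λ X a → (con (+ 0) :* a :+ X :* con (+ 1)) :* a := X :* a) refl

  -q-inverseˡ : ∀ x → ((-q x) +q x) ≈q 0q
  -q-inverseˡ x = ≈q-pointwise λ n → eqn (numₙ x n) (pw p (den x)) (pw p (den x ℕ.+ den x))
    where
    eqn : ∀ X a b → ((ℤ.- X) ℤ.* a ℤ.+ X ℤ.* a) ℤ.* + 1 ≡ + 0 ℤ.* b
    eqn = solve 3 (λ X a b → ((:- X) :* a :+ X :* a) :* con (+ 1) := con (+ 0) :* b) refl

  *q-assoc : ∀ x y z → ((x *q y) *q z) ≈q (x *q (y *q z))
  *q-assoc x y z = ≈q-pointwise λ n → eqn′ (numₙ x n) (numₙ y n) (numₙ z n) _ _ (cong (pw p) (sym (ℕ.+-assoc (den x) (den y) (den z))))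
    where
    eqn : ∀ X Y Z u → ((X ℤ.* Y) ℤ.* Z) ℤ.* u ≡ (X ℤ.* (Y ℤ.* Z)) ℤ.* u
    eqn = solve 4 (λ X Y Z u → ((X :* Y) :* Z) :* u := (X :* (Y :* Z)) :* u) refl
    eqn′ : ∀ X Y Z u v → u ≡ v → ((X ℤ.* Y) ℤ.* Z) ℤ.* u ≡ (X ℤ.* (Y ℤ.* Z)) ℤ.* v
    eqn′ X Y Z u _ refl = eqn X Y Z u

  *q-comm : ∀ x y → (x *q y) ≈q (y *q x)
  *q-comm x y = ≈q-pointwise λ n → eqn′ (numₙ x n) (numₙ y n) _ _ (cong (pw p) (ℕ.+-comm (den y) (den x)))
    where
    eqn : ∀ X Y u → (X ℤ.* Y) ℤ.* u ≡ (Y ℤ.* X) ℤ.* u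
    eqn = solve 3 (λ X Y u → (X :* Y) :* u := (Y :* X) :* u) refl
    eqn′ : ∀ X Y u v → u ≡ v → (X ℤ.* Y) ℤ.* u ≡ (Y ℤ.* X) ℤ.* v
    eqn′ X Y u _ refl = eqn X Y u

  *q-identityˡ : ∀ x → (1q *q x) ≈q x
  *q-identityˡ x = ≈q-pointwise λ n → eqn (numₙ x n) (pw p (den x))
    where
    eqn : ∀ X a → (+ 1 ℤ.* X) ℤ.* a ≡ X ℤ.* a
    eqn = solve 2 (λ X a → (con (+ 1) :* X) :* a := X :* a) refl

  *q-distribʳ : ∀ x y z → ((y +q z) *q x) ≈q ((y *q x) +q (z *q x))
  *q-distribʳ x y z = ≈q-pointwise λ n → eqn′ (numₙ x n) (numₙ y n) (numₙ z n) (pw p (den y)) (pw p (den z)) (pw p (den x)) _ _ _ _ _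
      (pw-+ (den y) (den x)) (pw-+ (den z) (den x)) (pw-+ (den y ℕ.+ den x) (den z ℕ.+ den x)) (pw-+ (den y) (den z)) (pw-+ (den y ℕ.+ den z) (den x))
    where
    eqn : ∀ X Y Z a b c → ((Y ℤ.* b ℤ.+ Z ℤ.* a) ℤ.* X) ℤ.* ((a ℤ.* c) ℤ.* (b ℤ.* c)) ≡ ((Y ℤ.* X) ℤ.* (b ℤ.* c) ℤ.+ (Z ℤ.* X) ℤ.* (a ℤ.* c)) ℤ.* ((a ℤ.* b) ℤ.* c)
    eqn = solve 6 (λ X Y Z a b c → ((Y :* b :+ Z :* a) :* X) :* ((a :* c) :* (b :* c)) := ((Y :* X) :* (b :* c) :+ (Z :* X) :* (a :* c)) :* ((a :* b) :* c)) refl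
    eqn′ : ∀ X Y Z a b c yx zx big1 yz big2 → yx ≡ a ℤ.* c → zx ≡ b ℤ.* c → big1 ≡ yx ℤ.* zx → yz ≡ a ℤ.* b → big2 ≡ yz ℤ.* c →
      ((Y ℤ.* b ℤ.+ Z ℤ.* a) ℤ.* X) ℤ.* big1 ≡ ((Y ℤ.* X) ℤ.* zx ℤ.+ (Z ℤ.* X) ℤ.* yx) ℤ.* big2
    eqn′ X Y Z a b c _ _ _ _ _ refl refl refl refl refl = eqn X Y Z a b c

  private
    ∣-linear : ∀ {k A B} → k ∣ A → k ∣ B → ∀ s t → k ∣ (A ℤ.* s ℤ.+ B ℤ.* t)
    ∣-linear e f s t = ∣m∣n⇒∣m+n (∣m⇒∣m*n s e) (∣m⇒∣m*n t f)

  +q-cong : ∀ {x x' y y'} → x ≈q x' → y ≈q y' → (x +q y) ≈q (x' +q y')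
  +q-cong {x} {x'} {y} {y'} (mk≈q e) (mk≈q f) = mk≈q λ n →
    subst (pw p n ∣_) (sym (eqn′ (numₙ x n) (numₙ x' n) (numₙ y n) (numₙ y' n) (pw p (den x)) (pw p (den x')) (pw p (den y)) (pw p (den y')) _ _
       (pw-+ (den x) (den y)) (pw-+ (den x') (den y'))))
      (∣-linear (e n) (f n) (pw p (den y) ℤ.* pw p (den y')) (pw p (den x) ℤ.* pw p (den x')))
    where
    eqn : ∀ X X' Y Y' a a' b b' → (X ℤ.* b ℤ.+ Y ℤ.* a) ℤ.* (a' ℤ.* b') ℤ.- (X' ℤ.* b' ℤ.+ Y' ℤ.* a') ℤ.* (a ℤ.* b) ≡
      (X ℤ.* a' ℤ.- X' ℤ.* a) ℤ.* (b ℤ.* b') ℤ.+ (Y ℤ.* b' ℤ.- Y' ℤ.* b) ℤ.* (a ℤ.* a')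
    eqn = solve 8 (λ X X' Y Y' a a' b b' → (X :* b :+ Y :* a) :* (a' :* b') :- (X' :* b' :+ Y' :* a') :* (a :* b) :=
      (X :* a' :- X' :* a) :* (b :* b') :+ (Y :* b' :- Y' :* b) :* (a :* a')) refl
    eqn′ : ∀ X X' Y Y' a a' b b' ab ab' → ab ≡ a ℤ.* b → ab' ≡ a' ℤ.* b' → (X ℤ.* b ℤ.+ Y ℤ.* a) ℤ.* ab' ℤ.- (X' ℤ.* b' ℤ.+ Y' ℤ.* a') ℤ.* ab ≡
      (X ℤ.* a' ℤ.- X' ℤ.* a) ℤ.* (b ℤ.* b') ℤ.+ (Y ℤ.* b' ℤ.- Y' ℤ.* b) ℤ.* (a ℤ.* a')
    eqn′ X X' Y Y' a a' b b' _ _ refl refl = eqn X X' Y Y' a a' b b'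

  *q-cong : ∀ {x x' y y'} → x ≈q x' → y ≈q y' → (x *q y) ≈q (x' *q y')
  *q-cong {x} {x'} {y} {y'} (mk≈q e) (mk≈q f) = mk≈q λ n →
    subst (pw p n ∣_) (sym (eqn′ (numₙ x n) (numₙ x' n) (numₙ y n) (numₙ y' n) (pw p (den x)) (pw p (den x')) (pw p (den y)) (pw p (den y')) _ _
       (pw-+ (den x) (den y)) (pw-+ (den x') (den y'))))
      (∣-linear (e n) (f n) (numₙ y n ℤ.* pw p (den y')) (numₙ x' n ℤ.* pw p (den x)))
    where
    eqn : ∀ X X' Y Y' a a' b b' → (X ℤ.* Y) ℤ.* (a' ℤ.* b') ℤ.- (X' ℤ.* Y') ℤ.* (a ℤ.* b) ≡
      (X ℤ.* a' ℤ.- X' ℤ.* a) ℤ.* (Y ℤ.* b') ℤ.+ (Y ℤ.* b' ℤ.- Y' ℤ.* b) ℤ.* (X' ℤ.* a)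
    eqn = solve 8 (λ X X' Y Y' a a' b b' → (X :* Y) :* (a' :* b') :- (X' :* Y') :* (a :* b) :=
      (X :* a' :- X' :* a) :* (Y :* b') :+ (Y :* b' :- Y' :* b) :* (X' :* a)) refl
    eqn′ : ∀ X X' Y Y' a a' b b' ab ab' → ab ≡ a ℤ.* b → ab' ≡ a' ℤ.* b' → (X ℤ.* Y) ℤ.* ab' ℤ.- (X' ℤ.* Y') ℤ.* ab ≡
      (X ℤ.* a' ℤ.- X' ℤ.* a) ℤ.* (Y ℤ.* b') ℤ.+ (Y ℤ.* b' ℤ.- Y' ℤ.* b) ℤ.* (X' ℤ.* a)
    eqn′ X X' Y Y' a a' b b' _ _ refl refl = eqn X X' Y Y' a a' b b'

  -q-cong : ∀ {x x'} → x ≈q x' → (-q x) ≈q (-q x')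
  -q-cong {x} {x'} (mk≈q e) = mk≈q λ n → subst (pw p n ∣_) (sym (eqn (numₙ x n) (numₙ x' n) (pw p (den x)) (pw p (den x')))) (∣m⇒∣-m (e n))
    where
    eqn : ∀ X X' a a' → (ℤ.- X) ℤ.* a' ℤ.- (ℤ.- X') ℤ.* a ≡ ℤ.- (X ℤ.* a' ℤ.- X' ℤ.* a)
    eqn = solve 4 (λ X X' a a' → (:- X) :* a' :- (:- X') :* a := :- (X :* a' :- X' :* a)) refl

  opaque
    unfolding p^_ _+ₚ_
    ≈q-trans : ∀ {x y z} → x ≈q y → y ≈q z → x ≈q z
    ≈q-trans {x} {y} {z} (mk≈q e) (mk≈q f) =
      mk≈q (un≈z (*-p^-cancelʳ (den y) {num x *ᶻ ιᶻ (pw p (den z))} {num z *ᶻ ιᶻ (pw p (den x))} (mk≈z λ n →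
        subst (pw p n ∣_) (sym (eqn (numₙ x n) (numₙ y n) (numₙ z n) (pw p (den x)) (pw p (den y)) (pw p (den z))))
          (∣-linear (e n) (f n) (pw p (den z)) (pw p (den x))))))
      where
      eqn : ∀ X Y Z a b c → (X ℤ.* c) ℤ.* b ℤ.- (Z ℤ.* a) ℤ.* b ≡ (X ℤ.* b ℤ.- Y ℤ.* a) ℤ.* c ℤ.+ (Y ℤ.* c ℤ.- Z ℤ.* b) ℤ.* a
      eqn = solve 6 (λ X Y Z a b c → (X :* c) :* b :- (Z :* a) :* b := (X :* b :- Y :* a) :* c :+ (Y :* c :- Z :* b) :* a) refl

  +q-identityʳ : ∀ x → (x +q 0q) ≈q x
  +q-identityʳ x = ≈q-trans {x +q 0q} {0q +q x} {x} (+q-comm x 0q) (+q-identityˡ x)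

  -q-inverseʳ : ∀ x → (x +q (-q x)) ≈q 0q
  -q-inverseʳ x = ≈q-trans {x +q (-q x)} {(-q x) +q x} {0q} (+q-comm x (-q x)) (-q-inverseˡ x)

  *q-identityʳ : ∀ x → (x *q 1q) ≈q x
  *q-identityʳ x = ≈q-trans {x *q 1q} {1q *q x} {x} (*q-comm x 1q) (*q-identityˡ x)

  *q-distribˡ : ∀ x y z → (x *q (y +q z)) ≈q ((x *q y) +q (x *q z))
  *q-distribˡ x y z = ≈q-trans {x *q (y +q z)} {(y +q z) *q x} {(x *q y) +q (x *q z)} (*q-comm x (y +q z))
    (≈q-trans {(y +q z) *q x} {(y *q x) +q (z *q x)} {(x *q y) +q (x *q z)} (*q-distribʳ x y z)
      (+q-cong {y *q x} {x *q y} {z *q x} {x *q z} (*q-comm y x) (*q-comm z x)))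

  +q-*q-isCommutativeRing : IsCommutativeRing _≈q_ _+q_ _*q_ -q_ 0q 1q
  +q-*q-isCommutativeRing = record
    { isRing = record
      { +-isAbelianGroup = record
        { isGroup = record
          { isMonoid = record
            { isSemigroup = record
              { isMagma = record { isEquivalence = record { refl = ≈q-refl ; sym = ≈q-sym ; trans = ≈q-trans } ; ∙-cong = +q-cong }
              ; assoc = +q-assoc }
            ; identity = +q-identityˡ , +q-identityʳ }
          ; inverse = -q-inverseˡ , -q-inverseʳ
          ; ⁻¹-cong = -q-cong }
        ; comm = +q-comm }
      ; *-cong = *q-cong
      ; *-assoc = *q-assoc
      ; *-identity = *q-identityˡ , *q-identityʳ
      ; distrib = *q-distribˡ , *q-distribʳ }
    ; *-comm = *q-comm }

  infixl 6 _+ℚ_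
  infixl 7 _*ℚ_
  infix  8 -ℚ_
  opaque
    _+ℚ_ _*ℚ_ : ℚₚ → ℚₚ → ℚₚ
    _+ℚ_ = _+q_
    _*ℚ_ = _*q_

    -ℚ_ : ℚₚ → ℚₚ
    -ℚ_ = -q_

    0ℚ 1ℚ : ℚₚ
    0ℚ = 0q
    1ℚ = 1q

  opaque
    unfolding _+ℚ_
    ℚₚ-isCommutativeRing : IsCommutativeRing _≈q_ _+ℚ_ _*ℚ_ -ℚ_ 0ℚ 1ℚ
    ℚₚ-isCommutativeRing = +q-*q-isCommutativeRing

  ℚₚ-ring : CommutativeRing 0ℓ 0ℓ
  ℚₚ-ring = record { isCommutativeRing = ℚₚ-isCommutativeRing }
  opaque
    unfolding _+ℚ_
    +ℚ≈+q : ∀ x y → x +ℚ y ≈q x +q y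
    +ℚ≈+q x y = ≈q-refl

    *ℚ≈*q : ∀ x y → x *ℚ y ≈q x *q y
    *ℚ≈*q x y = ≈q-refl

    -ℚ≈-q : ∀ x → -ℚ x ≈q -q x
    -ℚ≈-q x = ≈q-refl

    1ℚ≈1q : 1ℚ ≈q 1q
    1ℚ≈1q = ≈q-refl

    0ℚ≈0q : 0ℚ ≈q 0q
    0ℚ≈0q = ≈q-refl

  opaque
    unfolding _+ℚ_ _+ₚ_
    ι-+ : ∀ a b → ι (a +ₚ b) ≈q ι a +ℚ ι b
    ι-+ a b = ≈q-pointwise λ n → eqn (seq a n) (seq b n)
      where
      eqn : ∀ x y → (x ℤ.+ y) ℤ.* + 1 ≡ (x ℤ.* + 1 ℤ.+ y ℤ.* + 1) ℤ.* + 1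
      eqn = solve 2 (λ x y → (x :+ y) :* con (+ 1) := (x :* con (+ 1) :+ y :* con (+ 1)) :* con (+ 1)) refl

    ι-* : ∀ a b → ι (a *ₚ b) ≈q ι a *ℚ ι b
    ι-* a b = ≈q-pointwise λ _ → refl

    ι-neg : ∀ a → ι (-ₚ a) ≈q -ℚ ι a
    ι-neg a = ≈q-pointwise λ _ → refl

    ι-0 : ι 0ₚ ≈q 0ℚ
    ι-0 = ≈q-refl

    ι-1 : ι 1ₚ ≈q 1ℚ
    ι-1 = ≈q-refl

  ι-cong : ∀ {a b} → a ≈z b → ι a ≈q ι b
  ι-cong {a} {b} (mk≈z e) = mk≈q λ n →
    subst (pw p n ∣_) (cong₂ ℤ._-_ (sym (ℤ.*-identityʳ (seq a n))) (sym (ℤ.*-identityʳ (seq b n)))) (e n)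

  module ≈q-Reasoning = Relation.Binary.Reasoning.Setoid (CommutativeRing.setoid ℚₚ-ring)

  pos-part neg-part : ℤ → ℕ
  pos-part (+ n)    = n
  pos-part -[1+ n ] = 0
  neg-part (+ n)    = 0
  neg-part -[1+ n ] = suc n

  pos-part≡k+neg-part : ∀ k → + pos-part k ≡ k ℤ.+ + neg-part k
  pos-part≡k+neg-part (+ n)    = sym (ℤ.+-identityʳ (+ n))
  pos-part≡k+neg-part -[1+ n ] = sym (ℤ.+-inverseˡ (+ suc n))

  opaque
    unfolding p^_
    pPow≈p^/p^ : ∀ k → pPow p k ≈q p^ (pos-part k) /p^ (neg-part k)
    pPow≈p^/p^ (+ n)    = ≈q-refl
    pPow≈p^/p^ -[1+ n ] = ≈q-refl

    p^/p^-cong : ∀ {a b c d} → a ℕ.+ d ≡ c ℕ.+ b → p^ a /p^ b ≈q p^ c /p^ d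
    p^/p^-cong {a} {b} {c} {d} a+d≡c+b = ≈q-pointwise λ _ → trans (sym (pw-+ a d)) (trans (cong (pw p) a+d≡c+b) (pw-+ c b))

    p^/p^-* : ∀ a b c d → (p^ a /p^ b) *q (p^ c /p^ d) ≈q p^ (a ℕ.+ c) /p^ (b ℕ.+ d)
    p^/p^-* a b c d = ≈q-pointwise λ _ → cong (ℤ._* pw p (b ℕ.+ d)) (sym (pw-+ a c))

    ι-p^ : ∀ k → ι (p^ k) ≈q pPow p (+ k)
    ι-p^ k = ≈q-refl

  p^/p^≈pPow : ∀ {a b} k → + a ≡ k ℤ.+ + b → p^ a /p^ b ≈q pPow p k
  p^/p^≈pPow {a} {b} k a≡k+b = ≈q-trans {p^ a /p^ b} {p^ (pos-part k) /p^ (neg-part k)} {pPow p k}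
    (p^/p^-cong (ℤ.+-injective (begin
      + (a ℕ.+ neg-part k)                  ≡⟨ ℤ.pos-+ a (neg-part k) ⟩
      + a ℤ.+ + neg-part k                  ≡⟨ cong (ℤ._+ + neg-part k) a≡k+b ⟩
      k ℤ.+ + b ℤ.+ + neg-part k            ≡⟨ swap k (+ b) (+ neg-part k) ⟩
      k ℤ.+ + neg-part k ℤ.+ + b            ≡⟨ cong (ℤ._+ + b) (pos-part≡k+neg-part k) ⟨
      + pos-part k ℤ.+ + b                  ≡⟨ ℤ.pos-+ (pos-part k) b ⟨
      + (pos-part k ℕ.+ b)                  ∎)))
    (≈q-sym {pPow p k} {p^ (pos-part k) /p^ (neg-part k)} (pPow≈p^/p^ k))
    where
    open ≡-Reasoning
    swap : ∀ k b n → k ℤ.+ b ℤ.+ n ≡ k ℤ.+ n ℤ.+ b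
    swap = solve 3 (λ k b n → k :+ b :+ n := k :+ n :+ b) refl

  pos-part-+ : ∀ k₁ k₂ → + (pos-part k₁ ℕ.+ pos-part k₂) ≡ (k₁ ℤ.+ k₂) ℤ.+ + (neg-part k₁ ℕ.+ neg-part k₂)
  pos-part-+ k₁ k₂ = begin
    + (pos-part k₁ ℕ.+ pos-part k₂)                              ≡⟨ ℤ.pos-+ (pos-part k₁) (pos-part k₂) ⟩
    + pos-part k₁ ℤ.+ + pos-part k₂                              ≡⟨ cong₂ ℤ._+_ (pos-part≡k+neg-part k₁) (pos-part≡k+neg-part k₂) ⟩
    (k₁ ℤ.+ + neg-part k₁) ℤ.+ (k₂ ℤ.+ + neg-part k₂)            ≡⟨ interchange k₁ (+ neg-part k₁) k₂ (+ neg-part k₂) ⟩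
    (k₁ ℤ.+ k₂) ℤ.+ (+ neg-part k₁ ℤ.+ + neg-part k₂)            ≡⟨ cong (λ t → (k₁ ℤ.+ k₂) ℤ.+ t) (ℤ.pos-+ (neg-part k₁) (neg-part k₂)) ⟨
    (k₁ ℤ.+ k₂) ℤ.+ + (neg-part k₁ ℕ.+ neg-part k₂)              ∎
    where
    open ≡-Reasoning
    interchange : ∀ a b c d → (a ℤ.+ b) ℤ.+ (c ℤ.+ d) ≡ (a ℤ.+ c) ℤ.+ (b ℤ.+ d)
    interchange = solve 4 (λ a b c d → (a :+ b) :+ (c :+ d) := (a :+ c) :+ (b :+ d)) refl

  pPow-+ : ∀ k₁ k₂ → pPow p (k₁ ℤ.+ k₂) ≈q pPow p k₁ *ℚ pPow p k₂
  pPow-+ k₁ k₂ = begin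
    pPow p (k₁ ℤ.+ k₂)                                       ≈⟨ p^/p^≈pPow (k₁ ℤ.+ k₂) (pos-part-+ k₁ k₂) ⟨
    p^ (pos-part k₁ ℕ.+ pos-part k₂) /p^ (neg-part k₁ ℕ.+ neg-part k₂)
      ≈⟨ p^/p^-* (pos-part k₁) (neg-part k₁) (pos-part k₂) (neg-part k₂) ⟨
    (p^ (pos-part k₁) /p^ neg-part k₁) *q (p^ (pos-part k₂) /p^ neg-part k₂)
      ≈⟨ *q-cong (pPow≈p^/p^ k₁) (pPow≈p^/p^ k₂) ⟨
    pPow p k₁ *q pPow p k₂                                   ≈⟨ *ℚ≈*q (pPow p k₁) (pPow p k₂) ⟨
    pPow p k₁ *ℚ pPow p k₂                                   ∎
    where open ≈q-Reasoning

  pPow-inverse : ∀ h → pPow p h *ℚ pPow p (ℤ.- h) ≈q 1ℚ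
  pPow-inverse h = begin
    pPow p h *ℚ pPow p (ℤ.- h)    ≈⟨ pPow-+ h (ℤ.- h) ⟨
    pPow p (h ℤ.+ ℤ.- h)          ≡⟨ cong (pPow p) (ℤ.+-inverseʳ h) ⟩
    pPow p (+ 0)                  ≈⟨ 1ℚ≈1q ⟨
    1ℚ                            ∎
    where open ≈q-Reasoning

  opaque
    unfolding p^_ _+ℚ_ _+ₚ_
    p^/p^≈p^/p^*ι⇒ : ∀ a b a′ b′ c → p^ a /p^ b ≈q (p^ a′ /p^ b′) *q ι c → p^ (a ℕ.+ b′) *ₚ 1ₚ ≈z p^ (a′ ℕ.+ b) *ₚ c
    p^/p^≈p^/p^*ι⇒ a b a′ b′ c (mk≈q e) = mk≈z λ n → subst (pw p n ∣_) (cong₂ ℤ._-_ (sym left) (sym (right n))) (e n)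
      where
      left : pw p (a ℕ.+ b′) ℤ.* + 1 ≡ pw p a ℤ.* pw p (b′ ℕ.+ 0)
      left = trans (ℤ.*-identityʳ _) (trans (cong (λ t → pw p (a ℕ.+ t)) (sym (ℕ.+-identityʳ b′))) (pw-+ a (b′ ℕ.+ 0)))
      right : ∀ n → pw p (a′ ℕ.+ b) ℤ.* seq c n ≡ (pw p a′ ℤ.* seq c n) ℤ.* pw p b
      right n = trans (cong (ℤ._* seq c n) (pw-+ a′ b)) (swap (pw p a′) (pw p b) (seq c n))
        where
        swap : ∀ x y z → (x ℤ.* y) ℤ.* z ≡ (x ℤ.* z) ℤ.* y
        swap = solve 3 (λ x y z → (x :* y) :* z := (x :* z) :* y) refl

  -- Clearing the denominators of both powers reduces this to p^(a′ + b) ∣ p^(a + b′) in ℤₚ.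
  pPow≈pPow*ι⇒≤ : ∀ k k′ c → pPow p k ≈q pPow p k′ *ℚ ι c → k′ ≤ k
  pPow≈pPow*ι⇒≤ k k′ c pᵏ≈pᵏ′c = cancel (subst₂ _≤_ k′-side k-side (ℤ.+≤+ a′+b≤a+b′))
    where
    a = pos-part k
    b = neg-part k
    a′ = pos-part k′
    b′ = neg-part k′
    a′+b≤a+b′ : a′ ℕ.+ b ℕ.≤ a ℕ.+ b′
    a′+b≤a+b′ = p^*unit≈p^*⇒≤ (a ℕ.+ b′) (a′ ℕ.+ b) IsUnit-1 (p^/p^≈p^/p^*ι⇒ a b a′ b′ c (begin
      p^ a /p^ b                       ≈⟨ pPow≈p^/p^ k ⟨
      pPow p k                         ≈⟨ pᵏ≈pᵏ′c ⟩
      pPow p k′ *ℚ ι c                 ≈⟨ *ℚ≈*q (pPow p k′) (ι c) ⟩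
      pPow p k′ *q ι c                 ≈⟨ *q-cong {pPow p k′} {p^ a′ /p^ b′} {ι c} {ι c} (pPow≈p^/p^ k′) ≈q-refl ⟩
      (p^ a′ /p^ b′) *q ι c            ∎))
      where open ≈q-Reasoning
    k′-side : + (a′ ℕ.+ b) ≡ k′ ℤ.+ (+ b′ ℤ.+ + b)
    k′-side = trans (ℤ.pos-+ a′ b) (trans (cong (ℤ._+ + b) (pos-part≡k+neg-part k′)) (ℤ.+-assoc k′ (+ b′) (+ b)))
    k-side : + (a ℕ.+ b′) ≡ k ℤ.+ (+ b′ ℤ.+ + b)
    k-side = trans (ℤ.pos-+ a b′) (trans (cong (ℤ._+ + b′) (pos-part≡k+neg-part k))
                   (trans (ℤ.+-assoc k (+ b) (+ b′)) (cong (λ t → k ℤ.+ t) (ℤ.+-comm (+ b) (+ b′)))))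
    cancel : ∀ {x y C} → x ℤ.+ C ≤ y ℤ.+ C → x ≤ y
    cancel {x} {y} {C} x+C≤y+C = subst₂ _≤_ (x+C-C≡x x C) (x+C-C≡x y C) (ℤ.+-monoˡ-≤ (ℤ.- C) x+C≤y+C)
      where
      x+C-C≡x : ∀ t C → t ℤ.+ C ℤ.+ ℤ.- C ≡ t
      x+C-C≡x = solve 2 (λ t C → t :+ C :+ :- C := t) refl

  module Mℚ = Matrix₂ ℚₚ-ring
  module Mℤ = Matrix₂ ℤₚ-ring
  open CommutativeRingUnits ℚₚ-ring using () renaming (IsUnit to IsUnitℚ)

  open CommutativeRing ℚₚ-ring using () renaming (+-cong to +ℚ-cong; -‿cong to -ℚ-cong)

  ≈M⇒≋ : ∀ {X Y} → X ≈M Y → X Mℚ.≋ Y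
  ≈M⇒≋ (a , b , c , d) = Mℚ.mk≋ (mk≈q a) (mk≈q b) (mk≈q c) (mk≈q d)

  ≋⇒≈M : ∀ {X Y} → X Mℚ.≋ Y → X ≈M Y
  ≋⇒≈M (Mℚ.mk≋ a b c d) = un≈q a , un≈q b , un≈q c , un≈q d

  ·≋⊙ : ∀ X Y → X · Y Mℚ.≋ X Mℚ.⊙ Y
  ·≋⊙ X Y = Mℚ.mk≋ (entry (m₁₁ X) (m₁₁ Y) (m₁₂ X) (m₂₁ Y)) (entry (m₁₁ X) (m₁₂ Y) (m₁₂ X) (m₂₂ Y))
                   (entry (m₂₁ X) (m₁₁ Y) (m₂₂ X) (m₂₁ Y)) (entry (m₂₁ X) (m₁₂ Y) (m₂₂ X) (m₂₂ Y))
    where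
    entry : ∀ a b c d → (a *q b) +q (c *q d) ≈q (a *ℚ b) +ℚ (c *ℚ d)
    entry a b c d = begin
      (a *q b) +q (c *q d)   ≈⟨ +q-cong {a *ℚ b} {a *q b} {c *ℚ d} {c *q d} (*ℚ≈*q a b) (*ℚ≈*q c d) ⟨
      (a *ℚ b) +q (c *ℚ d)   ≈⟨ +ℚ≈+q (a *ℚ b) (c *ℚ d) ⟨
      (a *ℚ b) +ℚ (c *ℚ d)   ∎
      where open ≈q-Reasoning

  det≈determinant : ∀ X → det X ≈q Mℚ.determinant X
  det≈determinant (mat a b c d) = begin
    (a *q d) +q (-q (b *q c))     ≈⟨ +q-cong {a *ℚ d} {a *q d} { -q (b *ℚ c)} { -q (b *q c)}
                                         (*ℚ≈*q a d) (-q-cong {b *ℚ c} {b *q c} (*ℚ≈*q b c)) ⟨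
    (a *ℚ d) +q (-q (b *ℚ c))     ≈⟨ +q-cong {a *ℚ d} {a *ℚ d} { -ℚ (b *ℚ c)} { -q (b *ℚ c)} ≈q-refl (-ℚ≈-q (b *ℚ c)) ⟨
    (a *ℚ d) +q (-ℚ (b *ℚ c))     ≈⟨ +ℚ≈+q (a *ℚ d) (-ℚ (b *ℚ c)) ⟨
    (a *ℚ d) +ℚ (-ℚ (b *ℚ c))     ∎
    where open ≈q-Reasoning

  m≋diag : ∀ a b → m a b Mℚ.≋ Mℚ.diag a b
  m≋diag a b = Mℚ.mk≋ ≈q-refl (≈q-sym 0ℚ≈0q) (≈q-sym 0ℚ≈0q) ≈q-refl

  opaque
    unfolding _+ₚ_
    detᶻ≈determinant : ∀ X → detᶻ X ≈z Mℤ.determinant X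
    detᶻ≈determinant X = CommutativeRing.refl ℤₚ-ring


  ι-IsUnit : ∀ {a} → IsUnitₚ a → IsUnitℚ (ι a)
  ι-IsUnit {a} (a′ , aa′≈1) = ι a′ , ≈q-trans (≈q-sym (ι-* a a′)) (≈q-trans (ι-cong aa′≈1) ι-1)

  ιM-cong : ∀ {X Y} → X Mℤ.≋ Y → ιM X Mℚ.≋ ιM Y
  ιM-cong (Mℤ.mk≋ a b c d) = Mℚ.mk≋ (ι-cong a) (ι-cong b) (ι-cong c) (ι-cong d)

  ιM-⊙ : ∀ X Y → ιM (X Mℤ.⊙ Y) Mℚ.≋ ιM X Mℚ.⊙ ιM Y
  ιM-⊙ X Y = Mℚ.mk≋ (entry (m₁₁ X) (m₁₁ Y) (m₁₂ X) (m₂₁ Y)) (entry (m₁₁ X) (m₁₂ Y) (m₁₂ X) (m₂₂ Y))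
                     (entry (m₂₁ X) (m₁₁ Y) (m₂₂ X) (m₂₁ Y)) (entry (m₂₁ X) (m₁₂ Y) (m₂₂ X) (m₂₂ Y))
    where
    entry : ∀ a b c d → ι (a *ₚ b +ₚ c *ₚ d) ≈q ι a *ℚ ι b +ℚ ι c *ℚ ι d
    entry a b c d = ≈q-trans (ι-+ (a *ₚ b) (c *ₚ d)) (+ℚ-cong (ι-* a b) (ι-* c d))

  ιM-determinant : ∀ X → ι (Mℤ.determinant X) ≈q Mℚ.determinant (ιM X)
  ιM-determinant (mat a b c d) =
    ≈q-trans (ι-+ (a *ₚ d) (-ₚ (b *ₚ c))) (+ℚ-cong (ι-* a d) (≈q-trans (ι-neg (b *ₚ c)) (-ℚ-cong (ι-* b c))))

  ιM-adjugate : ∀ X → Mℚ.adjugate (ιM X) Mℚ.≋ ιM (Mℤ.adjugate X)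
  ιM-adjugate (mat a b c d) = Mℚ.mk≋ ≈q-refl (≈q-sym (ι-neg b)) (≈q-sym (ι-neg c)) ≈q-refl

  ιM-diag : ∀ a b → ιM (Mℤ.diag a b) Mℚ.≋ Mℚ.diag (ι a) (ι b)
  ιM-diag a b = Mℚ.mk≋ ≈q-refl ι-0 ι-0 ≈q-refl

  opaque
    unfolding _+ℚ_
    IsUnitq⇒IsUnitℚ : ∀ {x} → IsUnitq x → IsUnitℚ x
    IsUnitq⇒IsUnitℚ (y , xy≈1) = y , mk≈q xy≈1

    IsUnitℚ⇒IsUnitq : ∀ {x} → IsUnitℚ x → IsUnitq x
    IsUnitℚ⇒IsUnitq (y , mk≈q xy≈1) = y , xy≈1

  opaque
    unfolding _+ℚ_ _+ₚ_ p^_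
    ≈-clearDenominator : ∀ x {E} → den x ≤ℕ E → x ≈q (p^ 0 /p^ E) *ℚ ι (num x *ₚ p^ (E ℕ.∸ den x))
    ≈-clearDenominator x {E} d≤E = ≈q-pointwise λ n →
      trans (cong (numₙ x n ℤ.*_) pw-split) (regroup (numₙ x n) (pw p (E ℕ.∸ den x)) (pw p (den x)))
      where
      pw-split : pw p (E ℕ.+ 0) ≡ pw p (E ℕ.∸ den x) ℤ.* pw p (den x)
      pw-split = trans (cong (pw p) (trans (ℕ.+-identityʳ E) (sym (ℕ.m∸n+n≡m d≤E)))) (pw-+ (E ℕ.∸ den x) (den x))
      regroup : ∀ X P Q → X ℤ.* (P ℤ.* Q) ≡ (+ 1 ℤ.* (X ℤ.* P)) ℤ.* Q
      regroup = solve 3 (λ X P Q → X :* (P :* Q) := (con (+ 1) :* (X :* P)) :* Q) refl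

    ι*ℚ≈1⇒*num≈p^ : ∀ a z → ι a *ℚ z ≈q 1ℚ → a *ₚ num z ≈z p^ (den z)
    ι*ℚ≈1⇒*num≈p^ a z (mk≈q e) = mk≈z λ n → subst (pw p n ∣_)
      (cong₂ ℤ._-_ (ℤ.*-identityʳ (seq a n ℤ.* seq (num z) n)) (ℤ.*-identityˡ (pw p (den z)))) (e n)

    *ℚ≈1⇒num*num≈p^ : ∀ x x′ → x *ℚ x′ ≈q 1ℚ → num x *ₚ num x′ ≈z p^ (den x ℕ.+ den x′)
    *ℚ≈1⇒num*num≈p^ x x′ (mk≈q e) = mk≈z λ n → subst (pw p n ∣_)
      (cong₂ ℤ._-_ (ℤ.*-identityʳ (numₙ x n ℤ.* numₙ x′ n)) (ℤ.*-identityˡ (pw p (den x ℕ.+ den x′)))) (e n)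

    -- Cross-multiplying  p^(−2E) α = x²  with x = num x / p^(den x).
    p⁻ᴱ²ι≈x²⇒ : ∀ E α x → ((p^ 0 /p^ E) *ℚ (p^ 0 /p^ E)) *ℚ ι α ≈q x *ℚ x →
                α *ₚ p^ (den x ℕ.+ den x) ≈z (num x *ₚ num x) *ₚ p^ (E ℕ.+ E)
    p⁻ᴱ²ι≈x²⇒ E α x (mk≈q e) = mk≈z λ n → subst (pw p n ∣_)
      (cong₂ ℤ._-_ (cong (ℤ._* pw p (den x ℕ.+ den x)) (ℤ.*-identityˡ (seq α n)))
                   (cong (λ t → (numₙ x n ℤ.* numₙ x n) ℤ.* pw p t) (ℕ.+-identityʳ (E ℕ.+ E))))
      (e n)

module DoubleCosets (p : ℕ) (p-prime : Prime p) where

  import Data.Nat.Base as ℕ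
  import Data.Nat.Properties as ℕ
  open import Data.Integer.Base as ℤ using (ℤ; +_; _≤_)
  import Data.Integer.Properties as ℤ
  open import Data.Integer.Divisibility.Signed using (_∣_; divides)
  open import Data.Integer.Solver using (module +-*-Solver)
  open import Data.Product.Base using (Σ; _×_; _,_; proj₁; proj₂)
  open import Relation.Binary.PropositionalEquality.Core using (_≡_; refl; subst; sym; trans; cong; cong₂)
  import Relation.Binary.PropositionalEquality
  open import Algebra.Bundles using (CommutativeRing)
  open import Defs

  open PAdicIntegers p p-prime
  open PAdicNumbers p p-prime
  open SmithNormalForm p p-prime using (SmithForm; smithNormalForm)
  open CommutativeRingUnits ℤₚ-ring using (IsUnit-1; IsUnit-*; IsUnit-resp) renaming (IsUnit to IsUnitₚ)
  module Uℚ = CommutativeRingUnits ℚₚ-ring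
  module ℚR = CommutativeRing ℚₚ-ring
  module ℤR = CommutativeRing ℤₚ-ring
  open Mℚ using (_⊙_; _≋_; ≋-refl; ≋-sym; ≋-trans; ⊙-cong; ⊙-congˡ; ⊙-congʳ; diag)

  record Decomposition (k l : ℤ) (M : M₂ ℚₚ) : Set where
    field
      left right           : Mℤ.Mat
      left-root right-root : ℤₚ
      left-root-unit       : IsUnitₚ left-root
      right-root-unit      : IsUnitₚ right-root
      determinant-left     : Mℤ.determinant left ≈z left-root *ₚ left-root
      determinant-right    : Mℤ.determinant right ≈z right-root *ₚ right-root
      M≋                   : M ≋ (ιM left ⊙ diag (pPow p k) (pPow p l)) ⊙ ιM right

  In𝒦-ιM : ∀ {X} r → IsUnitₚ r → Mℤ.determinant X ≈z r *ₚ r → In𝒦 (ιM X)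
  In𝒦-ιM {X} r r-unit det-X≈r² = inK X (≋⇒≈M (≋-refl {ιM X}))
    (IsUnit⇒IsUnitᶻ (IsUnit-resp (ℤR.trans (detᶻ≈determinant X) det-X≈r²) (IsUnit-* r-unit r-unit)))
    (r , IsUnit⇒IsUnitᶻ r-unit , un≈z (ℤR.trans (detᶻ≈determinant X) (ℤR.trans det-X≈r² (*ₚ≈*ᶻ r r))))

  private
    𝒦-Data : M₂ ℚₚ → Set
    𝒦-Data A = Σ Mℤ.Mat λ X → Σ ℤₚ λ r → IsUnitₚ r × Mℤ.determinant X ≈z r *ₚ r × A ≋ ιM X

    𝒦-data : ∀ {A} → In𝒦 A → 𝒦-Data A
    𝒦-data (inK X A≈X _ (r , r-unit , det-X≈r²)) =
      X , r , IsUnitᶻ⇒IsUnit r-unit ,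
      ℤR.trans (ℤR.sym (detᶻ≈determinant X)) (ℤR.trans (mk≈z det-X≈r²) (ℤR.sym (*ₚ≈*ᶻ r r))) , ≈M⇒≋ A≈X

  fromDoubleCoset : ∀ {k l M} → InDoubleCoset p k l M → Decomposition k l M
  fromDoubleCoset {k} {l} {M} (A , B , A∈𝒦 , B∈𝒦 , M≈AmB) = decomposition (𝒦-data A∈𝒦) (𝒦-data B∈𝒦)
    where
    decomposition : 𝒦-Data A → 𝒦-Data B → Decomposition k l M
    decomposition (X , r , r-unit , det-X , A≋X) (Z , s , s-unit , det-Z , B≋Z) = record
      { left = X ; right = Z ; left-root = r ; right-root = s ; left-root-unit = r-unit ; right-root-unit = s-unit
      ; determinant-left = det-X ; determinant-right = det-Z
      ; M≋ = begin
          M                                          ≈⟨ ≈M⇒≋ M≈AmB ⟩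
          (A · m (pPow p k) (pPow p l)) · B          ≈⟨ ·≋⊙ (A · m (pPow p k) (pPow p l)) B ⟩
          (A · m (pPow p k) (pPow p l)) ⊙ B          ≈⟨ ⊙-congʳ (·≋⊙ A (m (pPow p k) (pPow p l))) ⟩
          (A ⊙ m (pPow p k) (pPow p l)) ⊙ B          ≈⟨ ⊙-cong (⊙-cong A≋X (m≋diag (pPow p k) (pPow p l))) B≋Z ⟩
          (ιM X ⊙ diag (pPow p k) (pPow p l)) ⊙ ιM Z ∎
      }
      where open Mℚ.≋-Reasoning

  toDoubleCoset : ∀ {k l M} → Decomposition k l M → InDoubleCoset p k l M
  toDoubleCoset {k} {l} {M} D = ιM left , ιM right ,
    In𝒦-ιM left-root left-root-unit determinant-left , In𝒦-ιM right-root right-root-unit determinant-right ,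
    ≋⇒≈M (begin
      M                                                          ≈⟨ M≋ ⟩
      (ιM left ⊙ diag (pPow p k) (pPow p l)) ⊙ ιM right          ≈⟨ ⊙-congʳ (⊙-congˡ (m≋diag (pPow p k) (pPow p l))) ⟨
      (ιM left ⊙ m (pPow p k) (pPow p l)) ⊙ ιM right             ≈⟨ ⊙-congʳ (·≋⊙ (ιM left) (m (pPow p k) (pPow p l))) ⟨
      (ιM left · m (pPow p k) (pPow p l)) ⊙ ιM right             ≈⟨ ·≋⊙ (ιM left · m (pPow p k) (pPow p l)) (ιM right) ⟨
      (ιM left · m (pPow p k) (pPow p l)) · ιM right             ∎)
    where
    open Decomposition D
    open Mℚ.≋-Reasoning

  determinant-decomposition : ∀ {k l M} (D : Decomposition k l M) → let open Decomposition D in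
    det M ≈q ι (Mℤ.determinant left *ₚ Mℤ.determinant right) *ℚ pPow p (k ℤ.+ l)
  determinant-decomposition {k} {l} {M} D = begin
    det M                                                        ≈⟨ det≈determinant M ⟩
    Mℚ.determinant M                                             ≈⟨ Mℚ.determinant-cong M≋ ⟩
    Mℚ.determinant ((ιM left ⊙ diag pᵏ pˡ) ⊙ ιM right)           ≈⟨ Mℚ.determinant-⊙⊙ (ιM left) (diag pᵏ pˡ) (ιM right) ⟩
    (Mℚ.determinant (ιM left) *ℚ Mℚ.determinant (diag pᵏ pˡ)) *ℚ Mℚ.determinant (ιM right)
      ≈⟨ ℚR.*-cong (ℚR.*-cong (ℚR.sym (ιM-determinant left)) (Mℚ.determinant-diag pᵏ pˡ)) (ℚR.sym (ιM-determinant right)) ⟩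
    (ι δₗ *ℚ (pᵏ *ℚ pˡ)) *ℚ ι δᵣ                                 ≈⟨ xy∙z≈xz∙y (ι δₗ) (pᵏ *ℚ pˡ) (ι δᵣ) ⟩
    (ι δₗ *ℚ ι δᵣ) *ℚ (pᵏ *ℚ pˡ)                                 ≈⟨ ℚR.*-cong (ℚR.sym (ι-* δₗ δᵣ)) (ℚR.sym (pPow-+ k l)) ⟩
    ι (δₗ *ₚ δᵣ) *ℚ pPow p (k ℤ.+ l)                             ∎
    where
    open Decomposition D
    open ≈q-Reasoning
    open import Algebra.Properties.CommutativeSemigroup ℚR.*-commutativeSemigroup using (xy∙z≈xz∙y)
    pᵏ pˡ : ℚₚ
    pᵏ = pPow p k
    pˡ = pPow p l
    δₗ δᵣ : ℤₚ
    δₗ = Mℤ.determinant left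
    δᵣ = Mℤ.determinant right

  square-of-unit⇒In𝒬 : ∀ {M Y} → Uℚ.IsUnit Y → det M ≈q Y *ℚ Y → In𝒬 M
  square-of-unit⇒In𝒬 {M} {Y} Y-unit det-M≈Y² =
    IsUnitℚ⇒IsUnitq (Uℚ.IsUnit-resp det-M≈Y² (Uℚ.IsUnit-* Y-unit Y-unit)) ,
    Y , IsUnitℚ⇒IsUnitq Y-unit , un≈q (ℚR.trans det-M≈Y² (*ℚ≈*q Y Y))

  -- With k + l = 2h, the determinant is the square of ι(rs) · pʰ, where r² and s² are the determinants of the integral factors.
  decomposition⇒In𝒬 : ∀ {k l M} → + 2 ∣ k ℤ.+ l → Decomposition k l M → In𝒬 M
  decomposition⇒In𝒬 {k} {l} {M} (divides h k+l≡h*2) D = square-of-unit⇒In𝒬 {M} Y-unit (begin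
    det M                                                  ≈⟨ determinant-decomposition D ⟩
    ι (Mℤ.determinant left *ₚ Mℤ.determinant right) *ℚ pPow p (k ℤ.+ l)
      ≈⟨ ℚR.*-cong (ι-cong (ℤR.*-cong determinant-left determinant-right)) (ℚR.reflexive (cong (pPow p) k+l≡h+h)) ⟩
    ι ((r *ₚ r) *ₚ (s *ₚ s)) *ℚ pPow p (h ℤ.+ h)           ≈⟨ ℚR.*-cong (ι-cong (interchange r r s s)) (pPow-+ h h) ⟩
    ι ((r *ₚ s) *ₚ (r *ₚ s)) *ℚ (pPow p h *ℚ pPow p h)     ≈⟨ ℚR.*-congʳ (ι-* (r *ₚ s) (r *ₚ s)) ⟩
    (ι (r *ₚ s) *ℚ ι (r *ₚ s)) *ℚ (pPow p h *ℚ pPow p h)   ≈⟨ interchangeℚ _ _ _ _ ⟩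
    Y *ℚ Y                                                 ∎)
    where
    open Decomposition D renaming (left-root to r; right-root to s)
    open ≈q-Reasoning
    open import Algebra.Properties.CommutativeSemigroup ℤR.*-commutativeSemigroup using (interchange)
    open import Algebra.Properties.CommutativeSemigroup ℚR.*-commutativeSemigroup using () renaming (interchange to interchangeℚ)
    Y : ℚₚ
    Y = ι (r *ₚ s) *ℚ pPow p h
    k+l≡h+h : k ℤ.+ l ≡ h ℤ.+ h
    k+l≡h+h = trans k+l≡h*2 (+-*-Solver.solve 1 (λ h → h +-*-Solver.:* +-*-Solver.con (+ 2) +-*-Solver.:= h +-*-Solver.:+ h) refl h)
    Y-unit : Uℚ.IsUnit Y
    Y-unit = Uℚ.IsUnit-* (ι-IsUnit (IsUnit-* left-root-unit right-root-unit)) (pPow p (ℤ.- h) , pPow-inverse h)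

  decomposition-determinant-unit : ∀ {k l M} (D : Decomposition k l M) → let open Decomposition D in
    IsUnitₚ (Mℤ.determinant left *ₚ Mℤ.determinant right)
  decomposition-determinant-unit D = IsUnit-*
    (IsUnit-resp determinant-left (IsUnit-* left-root-unit left-root-unit))
    (IsUnit-resp determinant-right (IsUnit-* right-root-unit right-root-unit))
    where open Decomposition D

  unit*pPow≈pPow*ι⇒≤ : ∀ {k k′ α c} → IsUnitₚ α → ι α *ℚ pPow p k ≈q pPow p k′ *ℚ ι c → k′ ≤ k
  unit*pPow≈pPow*ι⇒≤ {k} {k′} {α} {c} α-unit@(α′ , _) αpᵏ≈pᵏ′c = pPow≈pPow*ι⇒≤ k k′ (c *ₚ α′) (begin
    pPow p k                       ≈⟨ Uℚ.unit-cancelˡ (proj₂ (ι-IsUnit α-unit)) αpᵏ≈pᵏ′c ⟩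
    ι α′ *ℚ (pPow p k′ *ℚ ι c)     ≈⟨ x∙yz≈y∙zx (ι α′) (pPow p k′) (ι c) ⟩
    pPow p k′ *ℚ (ι c *ℚ ι α′)     ≈⟨ ℚR.*-congˡ (ι-* c α′) ⟨
    pPow p k′ *ℚ ι (c *ₚ α′)       ∎)
    where
    open ≈q-Reasoning
    open import Algebra.Properties.CommutativeSemigroup ℚR.*-commutativeSemigroup using (x∙yz≈y∙zx)

  pPow-≤ : ∀ {k l} → k ≤ l → Σ ℕ λ n → pPow p l ≈q pPow p k *ℚ ι (p^ n)
  pPow-≤ {k} {l} k≤l = ℤ.∣ l ℤ.- k ∣ , (begin
    pPow p l                               ≡⟨ cong (pPow p) l≡k+∣l-k∣ ⟩
    pPow p (k ℤ.+ + ℤ.∣ l ℤ.- k ∣)         ≈⟨ pPow-+ k (+ ℤ.∣ l ℤ.- k ∣) ⟩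
    pPow p k *ℚ pPow p (+ ℤ.∣ l ℤ.- k ∣)   ≈⟨ ℚR.*-congˡ (ι-p^ ℤ.∣ l ℤ.- k ∣) ⟨
    pPow p k *ℚ ι (p^ ℤ.∣ l ℤ.- k ∣)       ∎)
    where
    open ≈q-Reasoning
    open +-*-Solver
    0≤l-k : + 0 ≤ l ℤ.- k
    0≤l-k = subst (_≤ l ℤ.- k) (ℤ.+-inverseʳ k) (ℤ.+-monoˡ-≤ (ℤ.- k) k≤l)
    l≡k+∣l-k∣ : l ≡ k ℤ.+ + ℤ.∣ l ℤ.- k ∣
    l≡k+∣l-k∣ = trans (solve 2 (λ l k → l := k :+ (l :- k)) refl l k) (cong (λ t → k ℤ.+ t) (sym (ℤ.0≤i⇒+∣i∣≡i 0≤l-k)))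

  -- The (1,1) entry of adj(A) · M · adj(B) is det(A) det(B) pᵏ on one side and lies in pᵏ′ ℤₚ on the other.
  min-exponent-≤ : ∀ {k l k′ l′ M} → k′ ≤ l′ → Decomposition k l M → Decomposition k′ l′ M → k′ ≤ k
  min-exponent-≤ {k} {l} {k′} {l′} {M} k′≤l′ D D′ = unit*pPow≈pPow*ι⇒≤ (decomposition-determinant-unit D) (begin
    ι α *ℚ pPow p k
      ≈⟨ ℚR.*-congʳ (ℚR.trans (ι-* (Mℤ.determinant A) (Mℤ.determinant B)) (ℚR.*-cong (ιM-determinant A) (ιM-determinant B))) ⟩
    (Mℚ.determinant (ιM A) *ℚ Mℚ.determinant (ιM B)) *ℚ pPow p k
      ≈⟨ Mℚ.m₁₁-of-equal-diagonal-forms (ιM A) (pPow p k) (pPow p l) (ιM B) (ιM A′) (pPow p k′) (pPow p l′) (ιM B′) A-B≋A′-B′ ⟩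
    (m₁₁ U *ℚ m₁₁ V) *ℚ pPow p k′ +ℚ (m₁₂ U *ℚ m₂₁ V) *ℚ pPow p l′
      ≈⟨ ℚR.+-cong (ℚR.*-congʳ (ℚR.trans (ℚR.*-cong (Mℚ.≈₁₁ U≋) (Mℚ.≈₁₁ V≋)) (ℚR.sym (ι-* _ _))))
                   (ℚR.*-cong (ℚR.trans (ℚR.*-cong (Mℚ.≈₁₂ U≋) (Mℚ.≈₂₁ V≋)) (ℚR.sym (ι-* _ _))) (proj₂ (pPow-≤ k′≤l′))) ⟩
    ι e *ℚ pPow p k′ +ℚ ι f *ℚ (pPow p k′ *ℚ ι (p^ n))
      ≈⟨ factor (ι e) (pPow p k′) (ι f) (ι (p^ n)) ⟩
    pPow p k′ *ℚ (ι e +ℚ ι f *ℚ ι (p^ n))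
      ≈⟨ ℚR.*-congˡ (ℚR.trans (ℚR.+-congˡ (ℚR.sym (ι-* f (p^ n)))) (ℚR.sym (ι-+ e (f *ₚ p^ n)))) ⟩
    pPow p k′ *ℚ ι (e +ₚ f *ₚ p^ n) ∎)
    where
    open Decomposition D renaming (left to A; right to B)
    open Decomposition D′ using () renaming (left to A′; right to B′; M≋ to M≋′)
    open ≈q-Reasoning
    open CommutativeRingSolver ℚₚ-ring using (solve; _:+_; _:*_; _:=_)
    n : ℕ
    n = proj₁ (pPow-≤ k′≤l′)
    α : ℤₚ
    α = Mℤ.determinant A *ₚ Mℤ.determinant B
    A-B≋A′-B′ : (ιM A ⊙ diag (pPow p k) (pPow p l)) ⊙ ιM B ≋ (ιM A′ ⊙ diag (pPow p k′) (pPow p l′)) ⊙ ιM B′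
    A-B≋A′-B′ = ≋-trans (≋-sym M≋) M≋′
    U V : Mℚ.Mat
    U = Mℚ.adjugate (ιM A) ⊙ ιM A′
    V = ιM B′ ⊙ Mℚ.adjugate (ιM B)
    U≋ : U ≋ ιM (Mℤ.adjugate A Mℤ.⊙ A′)
    U≋ = ≋-trans (⊙-congʳ (ιM-adjugate A)) (≋-sym (ιM-⊙ (Mℤ.adjugate A) A′))
    V≋ : V ≋ ιM (B′ Mℤ.⊙ Mℤ.adjugate B)
    V≋ = ≋-trans (⊙-congˡ (ιM-adjugate B)) (≋-sym (ιM-⊙ B′ (Mℤ.adjugate B)))
    e f : ℤₚ
    e = m₁₁ (Mℤ.adjugate A Mℤ.⊙ A′) *ₚ m₁₁ (B′ Mℤ.⊙ Mℤ.adjugate B)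
    f = m₁₂ (Mℤ.adjugate A Mℤ.⊙ A′) *ₚ m₂₁ (B′ Mℤ.⊙ Mℤ.adjugate B)
    factor : ∀ e q f r → e *ℚ q +ℚ f *ℚ (q *ℚ r) ≈q q *ℚ (e +ℚ f *ℚ r)
    factor = solve 4 (λ e q f r → e :* q :+ f :* (q :* r) := q :* (e :+ f :* r)) ℚR.refl

  exponent-sum-≤ : ∀ {k l k′ l′ M} → Decomposition k l M → Decomposition k′ l′ M → k′ ℤ.+ l′ ≤ k ℤ.+ l
  exponent-sum-≤ {k} {l} {k′} {l′} {M} D D′ = unit*pPow≈pPow*ι⇒≤ (decomposition-determinant-unit D) (begin
    ι α *ℚ pPow p (k ℤ.+ l)           ≈⟨ determinant-decomposition D ⟨
    det M                             ≈⟨ determinant-decomposition D′ ⟩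
    ι α′ *ℚ pPow p (k′ ℤ.+ l′)        ≈⟨ ℚR.*-comm (ι α′) (pPow p (k′ ℤ.+ l′)) ⟩
    pPow p (k′ ℤ.+ l′) *ℚ ι α′        ∎)
    where
    open ≈q-Reasoning
    α α′ : ℤₚ
    α  = Mℤ.determinant (Decomposition.left D) *ₚ Mℤ.determinant (Decomposition.right D)
    α′ = Mℤ.determinant (Decomposition.left D′) *ₚ Mℤ.determinant (Decomposition.right D′)

  decomposition-unique : ∀ {k l k′ l′ M} → k ≤ l → k′ ≤ l′ →
    Decomposition k l M → Decomposition k′ l′ M → k ≡ k′ × l ≡ l′
  decomposition-unique {k} {l} {k′} {l′} k≤l k′≤l′ D D′ = k≡k′ , (begin
    l                     ≡⟨ l≡k+l-k k l ⟩
    (k ℤ.+ l) ℤ.- k       ≡⟨ cong₂ ℤ._-_ k+l≡k′+l′ k≡k′ ⟩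
    (k′ ℤ.+ l′) ℤ.- k′    ≡⟨ l≡k+l-k k′ l′ ⟨
    l′                    ∎)
    where
    open Relation.Binary.PropositionalEquality.≡-Reasoning
    k≡k′ : k ≡ k′
    k≡k′ = ℤ.≤-antisym (min-exponent-≤ k≤l D′ D) (min-exponent-≤ k′≤l′ D D′)
    k+l≡k′+l′ : k ℤ.+ l ≡ k′ ℤ.+ l′
    k+l≡k′+l′ = ℤ.≤-antisym (exponent-sum-≤ D′ D) (exponent-sum-≤ D D′)
    l≡k+l-k : ∀ k l → l ≡ (k ℤ.+ l) ℤ.- k
    l≡k+l-k = +-*-Solver.solve 2 (λ k l → l +-*-Solver.:= (k +-*-Solver.:+ l) +-*-Solver.:- k) refl

  p⁻^ : ℕ → ℚₚ
  p⁻^ E = p^ 0 /p^ E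

  clearDenominators : ∀ M → Σ ℕ λ E → Σ Mℤ.Mat λ N → M ≋ Mℚ.scale (p⁻^ E) (ιM N)
  clearDenominators M = E , mat (integral (m₁₁ M)) (integral (m₁₂ M)) (integral (m₂₁ M)) (integral (m₂₂ M)) ,
    Mℚ.mk≋ (≈-clearDenominator (m₁₁ M) d₁≤E) (≈-clearDenominator (m₁₂ M) d₂≤E)
           (≈-clearDenominator (m₂₁ M) d₃≤E) (≈-clearDenominator (m₂₂ M) d₄≤E)
    where
    d₁ d₂ d₃ d₄ E : ℕ
    d₁ = den (m₁₁ M)
    d₂ = den (m₁₂ M)
    d₃ = den (m₂₁ M)
    d₄ = den (m₂₂ M)
    E = (d₁ ℕ.+ d₂) ℕ.+ (d₃ ℕ.+ d₄)
    integral : ℚₚ → ℤₚ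
    integral x = num x *ₚ p^ (E ℕ.∸ den x)
    d₁≤E : d₁ ℕ.≤ E
    d₁≤E = ℕ.≤-trans (ℕ.m≤m+n d₁ d₂) (ℕ.m≤m+n (d₁ ℕ.+ d₂) (d₃ ℕ.+ d₄))
    d₂≤E : d₂ ℕ.≤ E
    d₂≤E = ℕ.≤-trans (ℕ.m≤n+m d₂ d₁) (ℕ.m≤m+n (d₁ ℕ.+ d₂) (d₃ ℕ.+ d₄))
    d₃≤E : d₃ ℕ.≤ E
    d₃≤E = ℕ.≤-trans (ℕ.m≤m+n d₃ d₄) (ℕ.m≤n+m (d₃ ℕ.+ d₄) (d₁ ℕ.+ d₂))
    d₄≤E : d₄ ℕ.≤ E
    d₄≤E = ℕ.≤-trans (ℕ.m≤n+m d₄ d₃) (ℕ.m≤n+m (d₃ ℕ.+ d₄) (d₁ ℕ.+ d₂))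

  p⁻^*ι-p^ : ∀ E a → p⁻^ E *ℚ ι (p^ a) ≈q pPow p (+ a ℤ.- + E)
  p⁻^*ι-p^ E a = begin
    p⁻^ E *ℚ ι (p^ a)                ≈⟨ *ℚ≈*q (p⁻^ E) (ι (p^ a)) ⟩
    p⁻^ E *q (p^ a /p^ 0)            ≈⟨ p^/p^-* 0 E a 0 ⟩
    p^ a /p^ (E ℕ.+ 0)               ≈⟨ p^/p^≈pPow (+ a ℤ.- + E) a≡a-E+E ⟩
    pPow p (+ a ℤ.- + E)             ∎
    where
    open ≈q-Reasoning
    a≡a-E+E : + a ≡ (+ a ℤ.- + E) ℤ.+ + (E ℕ.+ 0)
    a≡a-E+E = trans (+-*-Solver.solve 2 (λ a E → a +-*-Solver.:= (a +-*-Solver.:- E) +-*-Solver.:+ E) refl (+ a) (+ E))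
                    (cong (λ t → (+ a ℤ.- + E) ℤ.+ + t) (sym (ℕ.+-identityʳ E)))

  smithForm⇒≋ : ∀ {M E N a b u A B} → M ≋ Mℚ.scale (p⁻^ E) (ιM N) →
    N Mℤ.≋ (A Mℤ.⊙ Mℤ.diag (p^ a) (p^ b *ₚ u)) Mℤ.⊙ B →
    M ≋ (ιM A ⊙ diag (pPow p (+ a ℤ.- + E)) (pPow p (+ b ℤ.- + E))) ⊙ ιM (Mℤ.diag 1ₚ u Mℤ.⊙ B)
  smithForm⇒≋ {M} {E} {N} {a} {b} {u} {A} {B} M≋sN N≋ADB = begin
    M                                                                  ≈⟨ M≋sN ⟩
    Mℚ.scale s (ιM N)                                                  ≈⟨ Mℚ.scale-cong s ιN≋ ⟩
    Mℚ.scale s ((ιM A ⊙ diag (ι (p^ a)) (ι (p^ b *ₚ u))) ⊙ ιM B)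
      ≈⟨ Mℚ.scale-⊙diag⊙ s (ι (p^ a)) (ι (p^ b *ₚ u)) (ιM A) (ιM B) ⟩
    (ιM A ⊙ diag (s *ℚ ι (p^ a)) (s *ℚ ι (p^ b *ₚ u))) ⊙ ιM B
      ≈⟨ ⊙-congʳ (⊙-congˡ (Mℚ.diag-cong ℚR.refl s*ι-p^u≈)) ⟩
    (ιM A ⊙ diag (s *ℚ ι (p^ a)) ((s *ℚ ι (p^ b)) *ℚ ι u)) ⊙ ιM B
      ≈⟨ Mℚ.⊙diag-split (s *ℚ ι (p^ a)) (s *ℚ ι (p^ b)) (ι u) (ιM A) (ιM B) ⟩
    (ιM A ⊙ diag (s *ℚ ι (p^ a)) (s *ℚ ι (p^ b))) ⊙ (diag 1ℚ (ι u) ⊙ ιM B)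
      ≈⟨ ⊙-cong (⊙-congˡ (Mℚ.diag-cong (p⁻^*ι-p^ E a) (p⁻^*ι-p^ E b))) diag⊙ιB≋ ⟩
    (ιM A ⊙ diag (pPow p (+ a ℤ.- + E)) (pPow p (+ b ℤ.- + E))) ⊙ ιM (Mℤ.diag 1ₚ u Mℤ.⊙ B) ∎
    where
    open Mℚ.≋-Reasoning
    s : ℚₚ
    s = p⁻^ E
    ιN≋ : ιM N ≋ (ιM A ⊙ diag (ι (p^ a)) (ι (p^ b *ₚ u))) ⊙ ιM B
    ιN≋ = ≋-trans (ιM-cong N≋ADB) (≋-trans (ιM-⊙ (A Mℤ.⊙ Mℤ.diag (p^ a) (p^ b *ₚ u)) B)
            (⊙-congʳ (≋-trans (ιM-⊙ A (Mℤ.diag (p^ a) (p^ b *ₚ u))) (⊙-congˡ (ιM-diag (p^ a) (p^ b *ₚ u))))))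
    s*ι-p^u≈ : s *ℚ ι (p^ b *ₚ u) ≈q (s *ℚ ι (p^ b)) *ℚ ι u
    s*ι-p^u≈ = ℚR.trans (ℚR.*-congˡ (ι-* (p^ b) u)) (ℚR.sym (ℚR.*-assoc s (ι (p^ b)) (ι u)))
    diag⊙ιB≋ : diag 1ℚ (ι u) ⊙ ιM B ≋ ιM (Mℤ.diag 1ₚ u Mℤ.⊙ B)
    diag⊙ιB≋ = ≋-sym (≋-trans (ιM-⊙ (Mℤ.diag 1ₚ u) B) (⊙-congʳ (≋-trans (ιM-diag 1ₚ u) (Mℚ.diag-cong ι-1 ℚR.refl))))

  -- num x = pʳ t with t a unit; comparing valuations in  pᴳ u · p^(2 den x) = (pʳ t)² · p^(2E)  makes u = t².
  p⁻^²*p^*unit≈square⇒ : ∀ {E G u x} → IsUnitₚ u → Uℚ.IsUnit x →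
    (p⁻^ E *ℚ p⁻^ E) *ℚ ι (p^ G *ₚ u) ≈q x *ℚ x →
    Σ ℕ λ r → Σ ℤₚ λ t → IsUnitₚ t × u ≈z t *ₚ t × G ℕ.+ (den x ℕ.+ den x) ≡ (r ℕ.+ r) ℕ.+ (E ℕ.+ E)
  p⁻^²*p^*unit≈square⇒ {E} {G} {u} {x} u-unit (x′ , xx′≈1) s²pᴳu≈x² with ∣p^⇒p^*unit (*ℚ≈1⇒num*num≈p^ x x′ xx′≈1)
  ... | r , t , t-unit , num-x≈pʳt = r , t , t-unit , proj₂ unique , proj₁ unique
    where
    open ≈z-Reasoning
    open CommutativeRingSolver ℤₚ-ring using (solve; _:*_; _:=_)
    d : ℕ
    d = den x
    unique : G ℕ.+ (d ℕ.+ d) ≡ (r ℕ.+ r) ℕ.+ (E ℕ.+ E) × u ≈z t *ₚ t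
    unique = p^*unit-unique u-unit (IsUnit-* t-unit t-unit) (begin
      p^ (G ℕ.+ (d ℕ.+ d)) *ₚ u                  ≈⟨ ℤR.*-congʳ (p^-+ G (d ℕ.+ d)) ⟩
      (p^ G *ₚ p^ (d ℕ.+ d)) *ₚ u                ≈⟨ swap (p^ G) (p^ (d ℕ.+ d)) u ⟩
      (p^ G *ₚ u) *ₚ p^ (d ℕ.+ d)                ≈⟨ p⁻ᴱ²ι≈x²⇒ E (p^ G *ₚ u) x s²pᴳu≈x² ⟩
      (num x *ₚ num x) *ₚ p^ (E ℕ.+ E)           ≈⟨ ℤR.*-congʳ (ℤR.*-cong num-x≈pʳt num-x≈pʳt) ⟩
      ((p^ r *ₚ t) *ₚ (p^ r *ₚ t)) *ₚ p^ (E ℕ.+ E) ≈⟨ regroup (p^ r) t (p^ (E ℕ.+ E)) ⟩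
      ((p^ r *ₚ p^ r) *ₚ p^ (E ℕ.+ E)) *ₚ (t *ₚ t) ≈⟨ ℤR.*-congʳ (ℤR.*-congʳ (p^-+ r r)) ⟨
      (p^ (r ℕ.+ r) *ₚ p^ (E ℕ.+ E)) *ₚ (t *ₚ t)   ≈⟨ ℤR.*-congʳ (p^-+ (r ℕ.+ r) (E ℕ.+ E)) ⟨
      p^ ((r ℕ.+ r) ℕ.+ (E ℕ.+ E)) *ₚ (t *ₚ t)     ∎)
      where
      swap : ∀ a b c → (a *ₚ b) *ₚ c ≈z (a *ₚ c) *ₚ b
      swap = solve 3 (λ a b c → (a :* b) :* c := (a :* c) :* b) ℤR.refl
      regroup : ∀ P t Q → ((P *ₚ t) *ₚ (P *ₚ t)) *ₚ Q ≈z ((P *ₚ P) *ₚ Q) *ₚ (t *ₚ t)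
      regroup = solve 3 (λ P t Q → ((P :* t) :* (P :* t)) :* Q := ((P :* P) :* Q) :* (t :* t)) ℤR.refl

  exponent-parity : ∀ {a b d r E} → (a ℕ.+ b) ℕ.+ (d ℕ.+ d) ≡ (r ℕ.+ r) ℕ.+ (E ℕ.+ E) →
    (+ a ℤ.- + E) ℤ.+ (+ b ℤ.- + E) ≡ (+ r ℤ.- + d) ℤ.* + 2
  exponent-parity {a} {b} {d} {r} {E} exponents = begin
    (+ a ℤ.- + E) ℤ.+ (+ b ℤ.- + E)                        ≡⟨ before (+ a) (+ b) (+ d) (+ E) ⟩
    ((+ a ℤ.+ + b) ℤ.+ (+ d ℤ.+ + d)) ℤ.- (+ d ℤ.+ + d) ℤ.- (+ E ℤ.+ + E)
      ≡⟨ cong (λ t → t ℤ.- (+ d ℤ.+ + d) ℤ.- (+ E ℤ.+ + E)) (trans (sym (pos-+₄ a b d d)) (trans (cong +_ exponents) (pos-+₄ r r E E))) ⟩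
    ((+ r ℤ.+ + r) ℤ.+ (+ E ℤ.+ + E)) ℤ.- (+ d ℤ.+ + d) ℤ.- (+ E ℤ.+ + E)
      ≡⟨ after (+ r) (+ E) (+ d) ⟩
    (+ r ℤ.- + d) ℤ.* + 2                                  ∎
    where
    open Relation.Binary.PropositionalEquality.≡-Reasoning
    open +-*-Solver
    pos-+₄ : ∀ a b c d → + ((a ℕ.+ b) ℕ.+ (c ℕ.+ d)) ≡ (+ a ℤ.+ + b) ℤ.+ (+ c ℤ.+ + d)
    pos-+₄ a b c d = trans (ℤ.pos-+ (a ℕ.+ b) (c ℕ.+ d)) (cong₂ ℤ._+_ (ℤ.pos-+ a b) (ℤ.pos-+ c d))
    before : ∀ a b d E → (a ℤ.- E) ℤ.+ (b ℤ.- E) ≡ ((a ℤ.+ b) ℤ.+ (d ℤ.+ d)) ℤ.- (d ℤ.+ d) ℤ.- (E ℤ.+ E)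
    before = solve 4 (λ a b d E → (a :- E) :+ (b :- E) := ((a :+ b) :+ (d :+ d)) :- (d :+ d) :- (E :+ E)) refl
    after : ∀ r E d → ((r ℤ.+ r) ℤ.+ (E ℤ.+ E)) ℤ.- (d ℤ.+ d) ℤ.- (E ℤ.+ E) ≡ (r ℤ.- d) ℤ.* + 2
    after = solve 3 (λ r E d → ((r :+ r) :+ (E :+ E)) :- (d :+ d) :- (E :+ E) := (r :- d) :* con (+ 2)) refl

  determinant-scale-ιM : ∀ {M E N} → M ≋ Mℚ.scale (p⁻^ E) (ιM N) →
    det M ≈q (p⁻^ E *ℚ p⁻^ E) *ℚ ι (Mℤ.determinant N)
  determinant-scale-ιM {M} {E} {N} M≋sN = begin
    det M                                                   ≈⟨ det≈determinant M ⟩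
    Mℚ.determinant M                                        ≈⟨ Mℚ.determinant-cong M≋sN ⟩
    Mℚ.determinant (Mℚ.scale (p⁻^ E) (ιM N))                ≈⟨ Mℚ.determinant-scale (p⁻^ E) (ιM N) ⟩
    (p⁻^ E *ℚ p⁻^ E) *ℚ Mℚ.determinant (ιM N)               ≈⟨ ℚR.*-congˡ (ιM-determinant N) ⟨
    (p⁻^ E *ℚ p⁻^ E) *ℚ ι (Mℤ.determinant N)                ∎
    where open ≈q-Reasoning

  determinant-smithForm : ∀ {N} (F : SmithForm N) → let open SmithForm F in
    Mℤ.determinant N ≈z p^ (exponent ℕ.+ (exponent ℕ.+ gap)) *ₚ unit
  determinant-smithForm {N} F = begin
    Mℤ.determinant N                                           ≈⟨ Mℤ.determinant-cong decomposition ⟩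
    Mℤ.determinant ((left Mℤ.⊙ Mℤ.diag pᵃ (pᵇ *ₚ unit)) Mℤ.⊙ right)
      ≈⟨ Mℤ.determinant-⊙⊙ left (Mℤ.diag pᵃ (pᵇ *ₚ unit)) right ⟩
    (Mℤ.determinant left *ₚ Mℤ.determinant (Mℤ.diag pᵃ (pᵇ *ₚ unit))) *ₚ Mℤ.determinant right
      ≈⟨ ℤR.*-cong (ℤR.*-cong determinant-left (Mℤ.determinant-diag pᵃ (pᵇ *ₚ unit))) determinant-right ⟩
    (1ₚ *ₚ (pᵃ *ₚ (pᵇ *ₚ unit))) *ₚ 1ₚ                        ≈⟨ ℤR.trans (ℤR.*-identityʳ _) (ℤR.*-identityˡ _) ⟩
    pᵃ *ₚ (pᵇ *ₚ unit)                                         ≈⟨ ℤR.*-assoc pᵃ pᵇ unit ⟨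
    (pᵃ *ₚ pᵇ) *ₚ unit                                         ≈⟨ ℤR.*-congʳ (p^-+ exponent (exponent ℕ.+ gap)) ⟨
    p^ (exponent ℕ.+ (exponent ℕ.+ gap)) *ₚ unit               ∎
    where
    open SmithForm F
    open ≈z-Reasoning
    pᵃ pᵇ : ℤₚ
    pᵃ = p^ exponent
    pᵇ = p^ (exponent ℕ.+ gap)

  -- Clear denominators, take the Smith normal form of the integral part and absorb its unit into the right factor;
  -- that unit is a square because det M is.
  In𝒬⇒decomposition : ∀ {M} → In𝒬 M → Σ ℤ λ k → Σ ℤ λ l → k ≤ l × (+ 2 ∣ k ℤ.+ l) × Decomposition k l M
  In𝒬⇒decomposition {M} ((Y , det-M*Y≈1) , x , x-unit , det-M≈x²) = fromSmithForm (smithNormalForm det-N*w≈pᶠ)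
    where
    E : ℕ
    E = proj₁ (clearDenominators M)
    N : Mℤ.Mat
    N = proj₁ (proj₂ (clearDenominators M))
    M≋sN : M ≋ Mℚ.scale (p⁻^ E) (ιM N)
    M≋sN = proj₂ (proj₂ (clearDenominators M))
    s² : ℚₚ
    s² = p⁻^ E *ℚ p⁻^ E
    W : ℚₚ
    W = s² *ℚ Y
    det-N*w≈pᶠ : Mℤ.determinant N *ₚ num W ≈z p^ (den W)
    det-N*w≈pᶠ = ι*ℚ≈1⇒*num≈p^ (Mℤ.determinant N) W (begin
      ι (Mℤ.determinant N) *ℚ (s² *ℚ Y)     ≈⟨ x∙yz≈yx∙z (ι (Mℤ.determinant N)) s² Y ⟩
      (s² *ℚ ι (Mℤ.determinant N)) *ℚ Y     ≈⟨ ℚR.*-congʳ (determinant-scale-ιM M≋sN) ⟨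
      det M *ℚ Y                            ≈⟨ *ℚ≈*q (det M) Y ⟩
      det M *q Y                            ≈⟨ mk≈q det-M*Y≈1 ⟩
      1q                                    ≈⟨ 1ℚ≈1q ⟨
      1ℚ                                    ∎)
      where
      open ≈q-Reasoning
      open import Algebra.Properties.CommutativeSemigroup ℚR.*-commutativeSemigroup using (x∙yz≈yx∙z)
    fromSmithForm : SmithForm N → Σ ℤ λ k → Σ ℤ λ l → k ≤ l × (+ 2 ∣ k ℤ.+ l) × Decomposition k l M
    fromSmithForm F = + a ℤ.- + E , + b ℤ.- + E , ℤ.+-monoˡ-≤ (ℤ.- + E) (ℤ.+≤+ (ℕ.m≤m+n a gap)) ,
      divides (+ r ℤ.- + den x) (exponent-parity {a} {b} {den x} {r} {E} exponents) , record
        { left = left ; right = Mℤ.diag 1ₚ unit Mℤ.⊙ right ; left-root = 1ₚ ; right-root = t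
        ; left-root-unit = IsUnit-1 ; right-root-unit = t-unit
        ; determinant-left = ℤR.trans determinant-left (ℤR.sym (ℤR.*-identityʳ 1ₚ))
        ; determinant-right = determinant-right′
        ; M≋ = smithForm⇒≋ M≋sN decomposition }
      where
      open SmithForm F renaming (exponent to a)
      b : ℕ
      b = a ℕ.+ gap
      s²pᵃ⁺ᵇu≈x² : s² *ℚ ι (p^ (a ℕ.+ b) *ₚ unit) ≈q x *ℚ x
      s²pᵃ⁺ᵇu≈x² = begin
        s² *ℚ ι (p^ (a ℕ.+ b) *ₚ unit)        ≈⟨ ℚR.*-congˡ (ι-cong (determinant-smithForm F)) ⟨
        s² *ℚ ι (Mℤ.determinant N)           ≈⟨ determinant-scale-ιM M≋sN ⟨
        det M                                ≈⟨ mk≈q det-M≈x² ⟩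
        x *q x                               ≈⟨ *ℚ≈*q x x ⟨
        x *ℚ x                               ∎
        where open ≈q-Reasoning
      square : Σ ℕ λ r → Σ ℤₚ λ t → IsUnitₚ t × unit ≈z t *ₚ t × (a ℕ.+ b) ℕ.+ (den x ℕ.+ den x) ≡ (r ℕ.+ r) ℕ.+ (E ℕ.+ E)
      square = p⁻^²*p^*unit≈square⇒ unit-isUnit (IsUnitq⇒IsUnitℚ x-unit) s²pᵃ⁺ᵇu≈x²
      r : ℕ
      r = proj₁ square
      t : ℤₚ
      t = proj₁ (proj₂ square)
      t-unit : IsUnitₚ t
      t-unit = proj₁ (proj₂ (proj₂ square))
      u≈t² : unit ≈z t *ₚ t
      u≈t² = proj₁ (proj₂ (proj₂ (proj₂ square)))
      exponents : (a ℕ.+ b) ℕ.+ (den x ℕ.+ den x) ≡ (r ℕ.+ r) ℕ.+ (E ℕ.+ E)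
      exponents = proj₂ (proj₂ (proj₂ (proj₂ square)))
      determinant-right′ : Mℤ.determinant (Mℤ.diag 1ₚ unit Mℤ.⊙ right) ≈z t *ₚ t
      determinant-right′ = begin
        Mℤ.determinant (Mℤ.diag 1ₚ unit Mℤ.⊙ right)                      ≈⟨ Mℤ.determinant-⊙ (Mℤ.diag 1ₚ unit) right ⟩
        Mℤ.determinant (Mℤ.diag 1ₚ unit) *ₚ Mℤ.determinant right         ≈⟨ ℤR.*-cong (Mℤ.determinant-diag 1ₚ unit) determinant-right ⟩
        (1ₚ *ₚ unit) *ₚ 1ₚ                                               ≈⟨ ℤR.trans (ℤR.*-identityʳ _) (ℤR.*-identityˡ unit) ⟩
        unit                                                             ≈⟨ u≈t² ⟩
        t *ₚ t                                                           ∎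
        where open ≈z-Reasoning

  In𝒬⇒InDoubleCoset : ∀ {M} → In𝒬 M → Σ ℤ λ k → Σ ℤ λ l → k ≤ l × (+ 2 ∣ k ℤ.+ l) × InDoubleCoset p k l M
  In𝒬⇒InDoubleCoset {M} M∈𝒬 = toInDoubleCoset (In𝒬⇒decomposition M∈𝒬)
    where
    toInDoubleCoset : (Σ ℤ λ k → Σ ℤ λ l → k ≤ l × (+ 2 ∣ k ℤ.+ l) × Decomposition k l M) →
                      Σ ℤ λ k → Σ ℤ λ l → k ≤ l × (+ 2 ∣ k ℤ.+ l) × InDoubleCoset p k l M
    toInDoubleCoset (k , l , k≤l , 2∣k+l , D) = k , l , k≤l , 2∣k+l , toDoubleCoset D

open import Defs
open import Data.Integer using (ℤ; _≤_; _+_; +_)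
open import Data.Integer.Divisibility.Signed using (_∣_)
open import Data.Product using (Σ; _×_; _,_)
open import Relation.Binary.PropositionalEquality using (_≡_)

mainTheorem3 : (p : ℕ) → Prime p →
    ((M : M₂ (ℚp p)) → In𝒬 M →
      Σ ℤ λ k → Σ ℤ λ l → k ≤ l × (+ 2 ∣ k + l) × InDoubleCoset p k l M)
    × ((k l : ℤ) → k ≤ l → (+ 2 ∣ k + l) → (M : M₂ (ℚp p)) →
      InDoubleCoset p k l M → In𝒬 M)
    × ((k l k′ l′ : ℤ) → k ≤ l → (+ 2 ∣ k + l) → k′ ≤ l′ → (+ 2 ∣ k′ + l′) →
      (M : M₂ (ℚp p)) → InDoubleCoset p k l M → InDoubleCoset p k′ l′ M →
      (k ≡ k′) × (l ≡ l′))
mainTheorem3 p p-prime =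
  (λ M M∈𝒬 → In𝒬⇒InDoubleCoset {M} M∈𝒬) ,
  (λ k l _ 2∣k+l M M∈𝒦m𝒦 → decomposition⇒In𝒬 {k} {l} {M} 2∣k+l (fromDoubleCoset M∈𝒦m𝒦)) ,
  (λ k l k′ l′ k≤l _ k′≤l′ _ M M∈𝒦m𝒦 M∈𝒦m′𝒦 →
    decomposition-unique {k} {l} {k′} {l′} {M} k≤l k′≤l′ (fromDoubleCoset M∈𝒦m𝒦) (fromDoubleCoset M∈𝒦m′𝒦))
  where open DoubleCosets p p-prime
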